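{- Let $n \ge 3$ and $v, w \in \mathfrak{S}_n$. The intersection $B(v) \cap B(w)$ is not boolean if and only if $\sigma_k\sigma_{k+1}\sigma_k \in B(v) \cap B(w)$ for some $k \in [1,n-2]$. Equivalently, $B(v) \cap B(w)$ fails to be boolean if and only if there exists $k \in [1,n-2]$ such that $k$ and $k+1$ are interlaced in both $v$ and $w$.
   Context: $\mathfrak{S}_n$ is the symmetric group, generated by the adjacent transpositions $\sigma_i=(i\ i+1)$, $i\in[1,n-1]$, and ordered by the Bruhat order. Permutations are composed right to left; a reduced word for $w$ is a word $a_1a_2\cdots a_\ell$ in the letters $[1,n-1]$ with $w=\sigma_{a_1}\cdots\sigma_{a_\ell}$ and $\ell$ equal to the length of $w$. For $w\in\mathfrak{S}_n$, $B(w)=\{u \in \mathfrak{S}_n : u \le w\}$ is the principal order ideal of $w$ in the Bruhat order. A permutation $u$ is boolean if $B(u)$ is isomorphic (as a poset) to a boolean algebra; an order ideal in the Bruhat order is boolean if all of its elements are boolean permutations. For $k\in[1,n-2]$, the letters $k$ and $k+1$ are interlaced in $w$ if the reduced words of $w$ contain both letters $k$ and $k+1$ and some reduced word of $w$ contains a (not necessarily consecutive) subsequence of the form $k,\,k+1,\,k$ or of the form $k+1,\,k,\,k+1$ (equivalently, every reduced word of $w$ does). -}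

module Defs where

open import Data.Nat using (ℕ; zero; suc; _+_; _∸_; _≤_; _<_; _<ᵇ_; _≡ᵇ_)
open import Data.Bool using (Bool; true; false; if_then_else_)
open import Data.List using (List; []; _∷_; length; foldl; applyUpTo; filterᵇ)
open import Data.List.Relation.Unary.All using (All)
open import Data.List.Membership.Propositional using (_∈_)
open import Data.List.Relation.Binary.Sublist.Propositional renaming (_⊆_ to _⊑_)
open import Data.List.Relation.Binary.Permutation.Propositional using (_↭_)
open import Data.Fin.Subset using (Subset) renaming (_⊆_ to _⊆ˢ_)
open import Data.Product using (Σ; ∃; ∃-syntax; _×_; _,_)
open import Data.Sum using (_⊎_)
open import Relation.Binary.PropositionalEquality using (_≡_)
open import Relation.Binary.Construct.Closure.ReflexiveTransitive using (Star)
open import Relation.Nullary using (¬_)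

-- Permutations of [1,n] are represented in one-line notation as lists
-- w = [w(1), ..., w(n)] of natural numbers.

idPerm : ℕ → List ℕ
idPerm n = applyUpTo suc n

IsPerm : ℕ → List ℕ → Set
IsPerm n w = w ↭ idPerm n

-- Entry at 1-based position p (default 0 outside the range).
at : List ℕ → ℕ → ℕ
at []       _             = 0
at (x ∷ xs) zero          = 0
at (x ∷ xs) (suc zero)    = x
at (x ∷ xs) (suc (suc p)) = at xs (suc p)

-- swapPos i j w = w · (i j) : exchanges the entries in (1-based) positions i and j.
swapPos : ℕ → ℕ → List ℕ → List ℕ
swapPos i j w = go 1 w
  where
  go : ℕ → List ℕ → List ℕ
  go p []       = []
  go p (x ∷ xs) =
    (if p ≡ᵇ i then at w j else if p ≡ᵇ j then at w i else x) ∷ go (suc p) xs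

-- One Bruhat step u → u·(i j) with i < j and u(i) < u(j)  (so ℓ(u (i j)) > ℓ(u)).
BStep : List ℕ → List ℕ → Set
BStep u u' = ∃[ i ] ∃[ j ] (1 ≤ i × i < j × j ≤ length u × at u i < at u j × u' ≡ swapPos i j u)

_≤B_ : List ℕ → List ℕ → Set
u ≤B w = Star BStep u w

inv : List ℕ → ℕ
inv []       = 0
inv (x ∷ xs) = length (filterᵇ (λ y → y <ᵇ x) xs) + inv xs

-- Product σ_{a₁}⋯σ_{aℓ} in 𝔖ₙ (right multiplication by σ_a swaps positions a, a+1).
prod : ℕ → List ℕ → List ℕ
prod n word = foldl (λ w a → swapPos a (suc a) w) (idPerm n) word

σ : ℕ → ℕ → List ℕ
σ n a = prod n (a ∷ [])

Letter : ℕ → ℕ → Set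
Letter n a = 1 ≤ a × a ≤ n ∸ 1

ReducedWord : ℕ → List ℕ → List ℕ → Set
ReducedWord n w word = All (Letter n) word × prod n word ≡ w × length word ≡ inv w

Interlaced : ℕ → ℕ → List ℕ → Set
Interlaced n k w =
  (∃[ word ] (ReducedWord n w word × k ∈ word × suc k ∈ word)) ×
  (∃[ word ] (ReducedWord n w word ×
     ((k ∷ suc k ∷ k ∷ []) ⊑ word ⊎ (suc k ∷ k ∷ suc k ∷ []) ⊑ word)))

IsBoolean : List ℕ → Set
IsBoolean u =
  ∃[ m ] Σ ((x : List ℕ) → x ≤B u → Subset m) λ f →
    (∀ x y (p : x ≤B u) (q : y ≤B u) → (x ≤B y → f x p ⊆ˢ f y q) × (f x p ⊆ˢ f y q → x ≤B y)) ×
    (∀ x y (p : x ≤B u) (q : y ≤B u) → f x p ≡ f y q → x ≡ y) ×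
    (∀ (S : Subset m) → ∃[ x ] Σ (x ≤B u) λ p → f x p ≡ S)

-- The order ideal B(v) ∩ B(w) is boolean: all its elements are boolean.
BooleanIntersection : List ℕ → List ℕ → Set
BooleanIntersection v w = ∀ u → u ≤B v → u ≤B w → IsBoolean u

-- By the subword property, the elements below w are the products of the subwords of a fixed
-- reduced word of w.  A reduced word without repeated letters gives a boolean ideal: appending a
-- new letter doubles the ideal, by the lifting property.  If a reduced word repeats a letter a, then
-- a − 1 or a + 1 occurs between two occurrences (otherwise the two copies of σₐ would commute
-- together and cancel), so it contains k, k+1, k or k+1, k, k+1 as a subword and lies above
-- σₖσₖ₊₁σₖ.  The ideal of σₖσₖ₊₁σₖ is not boolean: its atoms σₖ and σₖ₊₁ have no join, since both
-- coatoms lie above both atoms.  Finally, σₖσₖ₊₁σₖ ≤ w exactly when k and k+1 are interlaced in w,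
-- as k, k+1, k and k+1, k, k+1 are the only reduced words of σₖσₖ₊₁σₖ.

module Submission where

open import Defs
open import Data.Bool using (Bool; true; false; if_then_else_)
open import Data.Empty using (⊥; ⊥-elim)
open import Data.Fin.Subset using (Subset; inside; outside; _∪_) renaming (_⊆_ to _⊆ˢ_; _∈_ to _∈ˢ_)
open import Data.Fin.Subset.Properties using (p⊆p∪q; q⊆p∪q; x∈p∪q⁻; ⊆-antisym)
open import Data.List using (List; []; _∷_; length; foldl; applyUpTo; filterᵇ; reverse; _++_)
open import Data.List.Membership.Propositional using (_∈_; _∉_)
open import Data.List.Membership.Propositional.Properties using (∈-∃++; ∈-++⁺ʳ)
open import Data.List.Properties using (length-++; length-applyUpTo; unfold-reverse; ≡-dec; length-reverse;
    reverse-involutive)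
open import Data.List.Relation.Binary.Equality.Propositional using (≋⇒≡)
open import Data.List.Relation.Binary.Permutation.Propositional using (_↭_; prep; swap; ↭-refl; ↭-trans; ↭⇒↭ₛ′)
open import Data.List.Relation.Binary.Permutation.Propositional.Properties using (↭-length)
open import Data.List.Relation.Binary.Sublist.Propositional using ([]; _∷ʳ_; _∷_) renaming (_⊆_ to _⊑_)
open import Data.List.Relation.Binary.Sublist.Propositional.Properties using ([]⊆-universal; ++⁺ˡ; Any-resp-⊆) renaming
    (reverse⁺ to sub-reverse⁺)
open import Data.List.Relation.Unary.All using (All; []; _∷_; tabulate) renaming
    (lookup to All-lookup; tail to All-tail)
open import Data.List.Relation.Unary.All.Properties using (++⁺; ++⁻)
open import Data.List.Relation.Unary.Any using (here; there)
import Data.List.Relation.Unary.Any.Properties as AnyP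
open import Data.List.Relation.Unary.Linked using (Linked; []; [-]; _∷_)
open import Data.List.Relation.Unary.Sorted.TotalOrder.Properties using (↗↭↗⇒≋)
open import Data.Nat
open import Data.Nat.Properties
open import Data.List.Membership.DecPropositional _≟_ using (_∈?_)
open import Data.Nat.Solver using (module +-*-Solver)
open import Data.Product using (Σ; ∃-syntax; _×_; _,_; proj₁; proj₂)
open import Data.Sum using (_⊎_; inj₁; inj₂; [_,_]′)
open import Data.Unit using (⊤; tt)
open import Data.Vec using ([]; _∷_)
open import Data.Vec.Base using (here; there)
import Data.Vec.Properties as Vec
open import Function.Base using (_∘_)
open import Function.Bundles using (_⇔_; mk⇔)
open import Function.Properties.Equivalence using () renaming (trans to ⇔-trans)
open import Relation.Binary.Bundles using (TotalOrder)
open import Relation.Binary.Construct.Closure.ReflexiveTransitive using (ε; _◅_; _◅◅_)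
open import Relation.Binary.Definitions using (tri<; tri≈; tri>)
open import Relation.Binary.PropositionalEquality
open import Relation.Nullary using (¬_; Dec; yes; no)
open import Relation.Nullary.Decidable using (_×-dec_)

open +-*-Solver

≡ᵇ-refl : ∀ p → (p ≡ᵇ p) ≡ true
≡ᵇ-refl zero    = refl
≡ᵇ-refl (suc p) = ≡ᵇ-refl p

≢⇒≡ᵇ-false : ∀ p i → p ≢ i → (p ≡ᵇ i) ≡ false
≢⇒≡ᵇ-false zero    zero    ne = ⊥-elim (ne refl)
≢⇒≡ᵇ-false zero    (suc i) ne = refl
≢⇒≡ᵇ-false (suc p) zero    ne = refl
≢⇒≡ᵇ-false (suc p) (suc i) ne = ≢⇒≡ᵇ-false p i (ne ∘ cong suc)

<⇒<ᵇ-true : ∀ m k → m < k → (m <ᵇ k) ≡ true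
<⇒<ᵇ-true zero (suc k) _ = refl
<⇒<ᵇ-true (suc m) (suc k) (s≤s lt) = <⇒<ᵇ-true m k lt

≮⇒<ᵇ-false : ∀ m k → ¬ (m < k) → (m <ᵇ k) ≡ false
≮⇒<ᵇ-false m zero _ = refl
≮⇒<ᵇ-false zero (suc k) ne = ⊥-elim (ne (s≤s z≤n))
≮⇒<ᵇ-false (suc m) (suc k) ne = ≮⇒<ᵇ-false m k (λ lt → ne (s≤s lt))

indicator : Bool → ℕ
indicator true = 1
indicator false = 0

indicator-mono : ∀ q u v → u < v → indicator (q <ᵇ u) ≤ indicator (q <ᵇ v)
indicator-mono q u v uv with q <? u
... | yes h rewrite <⇒<ᵇ-true q u h | <⇒<ᵇ-true q v (<-trans h uv) = ≤-refl
... | no h rewrite ≮⇒<ᵇ-false q u h = z≤n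

n≢1+n : ∀ n → n ≢ suc n
n≢1+n n e = 1+n≢n (sym e)

2+n≢n : ∀ k → suc (suc k) ≢ k
2+n≢n k e = <-irrefl (sym e) (≤-trans (n<1+n k) (n≤1+n _))

≤∸2⇒2+≤ : ∀ m k → 1 ≤ k → k ≤ m ∸ 2 → suc (suc k) ≤ m
≤∸2⇒2+≤ zero          (suc k) _ ()
≤∸2⇒2+≤ (suc zero)    (suc k) _ ()
≤∸2⇒2+≤ (suc (suc m)) k       _ k≤m = s≤s (s≤s k≤m)

2+≤⇒≤∸2 : ∀ m k → suc (suc k) ≤ m → k ≤ m ∸ 2
2+≤⇒≤∸2 (suc (suc m)) k (s≤s (s≤s k≤m)) = k≤m

≤∸1⇒1+≤ : ∀ m a → 1 ≤ a → a ≤ m ∸ 1 → suc a ≤ m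
≤∸1⇒1+≤ zero    (suc a) _ ()
≤∸1⇒1+≤ (suc m) a       _ a≤m = s≤s a≤m

1+≤⇒≤∸1 : ∀ m a → suc a ≤ m → a ≤ m ∸ 1
1+≤⇒≤∸1 (suc m) a (s≤s a≤m) = a≤m

boundedSearch : (Q : ℕ → Set) → (∀ a → Dec (Q a)) → ∀ N → (Σ ℕ λ a → a < N × Q a) ⊎ (∀ a → a < N → ¬ Q a)
boundedSearch Q d zero = inj₂ (λ a ())
boundedSearch Q d (suc N) with boundedSearch Q d N
... | inj₁ (a , lt , q) = inj₁ (a , <-trans lt (n<1+n N) , q)
... | inj₂ h with d N
...   | yes q = inj₁ (N , n<1+n N , q)
...   | no ¬q = inj₂ (λ a lt → [ h a , (λ { refl → ¬q }) ]′ (m<1+n⇒m<n∨m≡n lt))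

-- Transpositions of positions

τ : ℕ → ℕ → ℕ → ℕ
τ i j p = if p ≡ᵇ i then j else if p ≡ᵇ j then i else p

τ-left : ∀ i j → τ i j i ≡ j
τ-left i j rewrite ≡ᵇ-refl i = refl

τ-right : ∀ i j → i ≢ j → τ i j j ≡ i
τ-right i j ne rewrite ≢⇒≡ᵇ-false j i (≢-sym ne) | ≡ᵇ-refl j = refl

τ-fixed : ∀ i j p → p ≢ i → p ≢ j → τ i j p ≡ p
τ-fixed i j p n1 n2 rewrite ≢⇒≡ᵇ-false p i n1 | ≢⇒≡ᵇ-false p j n2 = refl

τ-involutive : ∀ i j p → τ i j (τ i j p) ≡ p
τ-involutive i j p with p ≟ i
... | yes refl with j ≟ p
...   | yes refl rewrite τ-left p p = τ-left p p
...   | no ne rewrite τ-left p j = τ-right p j (≢-sym ne)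
τ-involutive i j p | no n1 with p ≟ j
...   | yes refl rewrite τ-right i p (≢-sym n1) = τ-left i p
...   | no n2 rewrite τ-fixed i j p n1 n2 = τ-fixed i j p n1 n2

τ-injective : ∀ i j p q → τ i j p ≡ τ i j q → p ≡ q
τ-injective i j p q e = trans (sym (τ-involutive i j p)) (trans (cong (τ i j) e) (τ-involutive i j q))

τ-conjugate : ∀ a b i j p → i ≢ j →
  τ a b (τ (τ a b i) (τ a b j) (τ a b p)) ≡ τ i j p
τ-conjugate a b i j p ij with τ a b p ≟ τ a b i
... | yes e rewrite e | τ-left (τ a b i) (τ a b j) | τ-involutive a b j | τ-injective a b p i e = sym (τ-left i j)
... | no n1 with τ a b p ≟ τ a b j
...   | yes e rewrite e | τ-right (τ a b i) (τ a b j) (λ q → ij (τ-injective a b i j q)) | τ-involutive a b i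
      | τ-injective a b p j e = sym (τ-right i j ij)
...   | no n2 rewrite τ-fixed (τ a b i) (τ a b j) (τ a b p) n1 n2 | τ-involutive a b p
        = sym (τ-fixed i j p (λ e → n1 (cong (τ a b) e)) (λ e → n2 (cong (τ a b) e)))

τ-commute : ∀ i j k l p → i ≢ k → i ≢ l → j ≢ k → j ≢ l →
  τ i j (τ k l p) ≡ τ k l (τ i j p)
τ-commute i j k l p ik il jk jl with p ≟ k
... | yes refl rewrite τ-left p l | τ-fixed i j l (≢-sym il) (≢-sym jl) | τ-fixed i j p (≢-sym ik) (≢-sym jk) =
      sym (τ-left k l)
... | no pk with p ≟ l
...   | yes refl rewrite τ-right k p (≢-sym pk) | τ-fixed i j k (≢-sym ik) (≢-sym jk)
      | τ-fixed i j p (≢-sym il) (≢-sym jl) = sym (τ-right k p (≢-sym pk))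
...   | no pl rewrite τ-fixed k l p pk pl with p ≟ i
...     | yes refl rewrite τ-left p j = sym (τ-fixed k l j jk jl)
...     | no pi with p ≟ j
...       | yes refl rewrite τ-right i p (≢-sym pi) = sym (τ-fixed k l i ik il)
...       | no pj rewrite τ-fixed i j p pi pj = sym (τ-fixed k l p pk pl)

τ-braidʳ₁ : ∀ a j p → j ≢ a → j ≢ suc a → τ a (suc a) (τ a j (τ (suc a) j p)) ≡ τ a j p
τ-braidʳ₁ a j p ja jb with p ≟ a
... | yes e rewrite e | τ-fixed (suc a) j a (n≢1+n a) (≢-sym ja) | τ-left a j | τ-fixed a (suc a) j ja jb = refl
... | no pa with p ≟ suc a
...   | yes e rewrite e | τ-left (suc a) j | τ-right a j (≢-sym ja) | τ-left a (suc a)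
      | τ-fixed a j (suc a) (1+n≢n) (≢-sym jb) = refl
...   | no pb with p ≟ j
...     | yes e rewrite e | τ-right (suc a) j (≢-sym jb) | τ-fixed a j (suc a) (1+n≢n) (≢-sym jb)
      | τ-right a (suc a) (n≢1+n a) | τ-right a j (≢-sym ja) = refl
...     | no pj rewrite τ-fixed (suc a) j p pb pj | τ-fixed a j p pa pj | τ-fixed a (suc a) p pa pb = refl

τ-braidʳ₂ : ∀ a j p → j ≢ a → j ≢ suc a → τ (suc a) j (τ a j p) ≡ τ a j (τ a (suc a) p)
τ-braidʳ₂ a j p ja jb with p ≟ a
... | yes e rewrite e | τ-left a j | τ-left a (suc a) | τ-right (suc a) j (≢-sym jb)
      | τ-fixed a j (suc a) (1+n≢n) (≢-sym jb) = refl
... | no pa with p ≟ suc a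
...   | yes e rewrite e | τ-fixed a j (suc a) (1+n≢n) (≢-sym jb) | τ-left (suc a) j | τ-right a (suc a) (n≢1+n a)
      | τ-left a j = refl
...   | no pb with p ≟ j
...     | yes e rewrite e | τ-right a j (≢-sym ja) | τ-fixed (suc a) j a (n≢1+n a) (≢-sym ja)
      | τ-fixed a (suc a) j ja jb | τ-right a j (≢-sym ja) = refl
...     | no pj rewrite τ-fixed a j p pa pj | τ-fixed (suc a) j p pb pj | τ-fixed a (suc a) p pa pb
      | τ-fixed a j p pa pj = refl

τ-braidˡ₁ : ∀ a i p → i ≢ a → i ≢ suc a → τ a (suc a) (τ i (suc a) (τ i a p)) ≡ τ i (suc a) p
τ-braidˡ₁ a i p ia ib with p ≟ i
... | yes e rewrite e | τ-left i a | τ-fixed i (suc a) a (≢-sym ia) (n≢1+n a) | τ-left a (suc a) | τ-left i (suc a) =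
      refl
... | no pi with p ≟ a
...   | yes e rewrite e | τ-right i a ia | τ-left i (suc a) | τ-right a (suc a) (n≢1+n a)
      | τ-fixed i (suc a) a (≢-sym ia) (n≢1+n a) = refl
...   | no pa with p ≟ suc a
...     | yes e rewrite e | τ-fixed i a (suc a) (≢-sym ib) (1+n≢n) | τ-right i (suc a) ib | τ-fixed a (suc a) i ia ib =
      refl
...     | no pb rewrite τ-fixed i a p pi pa | τ-fixed i (suc a) p pi pb | τ-fixed a (suc a) p pa pb = refl

τ-braidˡ₂ : ∀ a i p → i ≢ a → i ≢ suc a → τ i a (τ i (suc a) p) ≡ τ i (suc a) (τ a (suc a) p)
τ-braidˡ₂ a i p ia ib with p ≟ i
... | yes e rewrite e | τ-left i (suc a) | τ-fixed i a (suc a) (≢-sym ib) (1+n≢n) | τ-fixed a (suc a) i ia ib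
      | τ-left i (suc a) = refl
... | no pi with p ≟ a
...   | yes e rewrite e | τ-fixed i (suc a) a (≢-sym ia) (n≢1+n a) | τ-right i a ia | τ-left a (suc a)
      | τ-right i (suc a) ib = refl
...   | no pa with p ≟ suc a
...     | yes e rewrite e | τ-right i (suc a) ib | τ-left i a | τ-right a (suc a) (n≢1+n a)
      | τ-fixed i (suc a) a (≢-sym ia) (n≢1+n a) = refl
...     | no pb rewrite τ-fixed i (suc a) p pi pb | τ-fixed i a p pi pa | τ-fixed a (suc a) p pa pb
      | τ-fixed i (suc a) p pi pb = refl

τ-adjacent-mono : ∀ a i j → i < j → ¬ (i ≡ a × j ≡ suc a) → τ a (suc a) i < τ a (suc a) j
τ-adjacent-mono a i j ij nn with i ≟ a
... | yes e with j ≟ suc a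
...   | yes f = ⊥-elim (nn (e , f))
...   | no f rewrite e | τ-left a (suc a) | τ-fixed a (suc a) j (λ g → <-irrefl (sym g) ij) f = ≤∧≢⇒< ij (≢-sym f)
τ-adjacent-mono a i j ij nn | no ia with i ≟ suc a
...   | yes e rewrite e | τ-right a (suc a) (n≢1+n a)
      | τ-fixed a (suc a) j (λ g → <-asym ij (subst (_< suc a) (sym g) (n<1+n a))) (λ g → <-irrefl (sym g) ij) =
      <-trans (n<1+n a) ij
...   | no ib rewrite τ-fixed a (suc a) i ia ib with j ≟ a
...     | yes f rewrite f | τ-left a (suc a) = <-trans ij (n<1+n a)
...     | no ja with j ≟ suc a
...       | yes f rewrite f | τ-right a (suc a) (n≢1+n a) = ≤∧≢⇒< (≤-pred ij) ia
...       | no jb rewrite τ-fixed a (suc a) j ja jb = ij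

τ-suc : ∀ i j q → τ (suc i) (suc j) (suc q) ≡ suc (τ i j q)
τ-suc i j q with q ≡ᵇ i | q ≡ᵇ j
... | true | _ = refl
... | false | true = refl
... | false | false = refl

τ-nonzero : ∀ i j q → 1 ≤ i → 1 ≤ j → 1 ≤ q → 1 ≤ τ i j q
τ-nonzero i j q i1 j1 q1 with q ≡ᵇ i | q ≡ᵇ j
... | true | _ = j1
... | false | true = i1
... | false | false = q1

SameSide : ℕ → ℕ → ℕ → Set
SameSide a i j = (i ≤ a × j ≤ a) ⊎ (a < i × a < j)

τ-SameSide-≤ : ∀ a i j t → SameSide a i j → t ≤ a → τ i j t ≤ a
τ-SameSide-≤ a i j t s ta with t ≟ i
... | yes q = subst (_≤ a) (sym (trans (cong (τ i j) q) (τ-left i j))) (f s)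
  where
  f : SameSide a i j → j ≤ a
  f (inj₁ (_ , h)) = h
  f (inj₂ (h , _)) = ⊥-elim (<-irrefl refl (<-≤-trans h (subst (_≤ a) q ta)))
... | no q1 with t ≟ j
...   | yes q = subst (_≤ a) (sym (trans (cong (τ i j) q) (τ-right i j (λ e → q1 (trans q (sym e)))))) (f s)
  where
  f : SameSide a i j → i ≤ a
  f (inj₁ (h , _)) = h
  f (inj₂ (_ , h)) = ⊥-elim (<-irrefl refl (<-≤-trans h (subst (_≤ a) q ta)))
...   | no q2 = subst (_≤ a) (sym (τ-fixed i j t q1 q2)) ta

τ-SameSide-> : ∀ a i j t → SameSide a i j → a < t → a < τ i j t
τ-SameSide-> a i j t s ta with t ≟ i
... | yes q = subst (a <_) (sym (trans (cong (τ i j) q) (τ-left i j))) (f s)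
  where
  f : SameSide a i j → a < j
  f (inj₁ (h , _)) = ⊥-elim (<-irrefl refl (<-≤-trans (subst (a <_) q ta) h))
  f (inj₂ (_ , h)) = h
... | no q1 with t ≟ j
...   | yes q = subst (a <_) (sym (trans (cong (τ i j) q) (τ-right i j (λ e → q1 (trans q (sym e)))))) (f s)
  where
  f : SameSide a i j → a < i
  f (inj₁ (_ , h)) = ⊥-elim (<-irrefl refl (<-≤-trans (subst (a <_) q ta) h))
  f (inj₂ (h , _)) = h
...   | no q2 = subst (a <_) (sym (τ-fixed i j t q1 q2)) ta

Outside : ℕ → ℕ → Set
Outside k t = t ≢ k × t ≢ suc k × t ≢ suc (suc k)

Outside-below : ∀ k a → a < k → Outside k a
Outside-below k a lt = (λ q → <-irrefl q lt) , (λ q → <-asym lt (subst (k <_) (sym q) (n<1+n k))) ,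
  (λ q → <-asym lt (subst (k <_) (sym q) (≤-trans (n<1+n k) (n≤1+n _))))

swapEntry : ℕ → ℕ → List ℕ → ℕ → ℕ → ℕ
swapEntry i j w p x = if p ≡ᵇ i then at w j else if p ≡ᵇ j then at w i else x

-- A copy of the local helper of swapPos, which cannot be referred to by name.  Abstracting
-- its arguments with 'with' (swapPos≡swapFrom) lets Agda infer it as g in swapFrom-unique.
swapFrom : ℕ → ℕ → List ℕ → ℕ → List ℕ → List ℕ
swapFrom i j w p []       = []
swapFrom i j w p (x ∷ xs) = swapEntry i j w p x ∷ swapFrom i j w (suc p) xs

swapFrom-unique : ∀ i j w {g : ℕ → List ℕ → List ℕ} →
  (∀ p → g p [] ≡ []) →
  (∀ p x xs → g p (x ∷ xs) ≡ swapEntry i j w p x ∷ g (suc p) xs) →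
  ∀ p xs → g p xs ≡ swapFrom i j w p xs
swapFrom-unique i j w g[] g∷ p []       = g[] p
swapFrom-unique i j w {g} g[] g∷ p (x ∷ xs) =
  trans (g∷ p x xs) (cong (swapEntry i j w p x ∷_) (swapFrom-unique i j w {g} g[] g∷ (suc p) xs))

swapPos≡swapFrom : ∀ i j w → swapPos i j w ≡ swapFrom i j w 1 w
swapPos≡swapFrom i j []       = refl
swapPos≡swapFrom i j (x ∷ xs) with x ∷ xs
... | w with swapFrom-unique i j w (λ _ → refl) (λ _ _ _ → refl) | 2 | xs
...   | unique | p | ys = cong (_ ∷_) (unique p ys)

length-swapFrom : ∀ i j w p V → length (swapFrom i j w p V) ≡ length V
length-swapFrom i j w p [] = refl
length-swapFrom i j w p (x ∷ V) = cong suc (length-swapFrom i j w (suc p) V)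

length-swapPos : ∀ i j w → length (swapPos i j w) ≡ length w
length-swapPos i j w rewrite swapPos≡swapFrom i j w = length-swapFrom i j w 1 w

at-zero : ∀ L → at L 0 ≡ 0
at-zero [] = refl
at-zero (x ∷ L) = refl

at-beyond : ∀ L r → length L ≤ r → at L (suc r) ≡ 0
at-beyond [] r le = refl
at-beyond (x ∷ []) (suc r) le = refl
at-beyond (x ∷ y ∷ L) (suc r) (s≤s le) = at-beyond (y ∷ L) r le

at-swapFrom : ∀ i j w q V r → r < length V → at (swapFrom i j w q V) (suc r) ≡ swapEntry i j w (q + r) (at V (suc r))
at-swapFrom i j w q (x ∷ V) zero lt rewrite +-identityʳ q = refl
at-swapFrom i j w q (x ∷ y ∷ V) (suc r) (s≤s lt) rewrite +-suc q r = at-swapFrom i j w (suc q) (y ∷ V) r lt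

swapEntry-at : ∀ i j w p → swapEntry i j w p (at w p) ≡ at w (τ i j p)
swapEntry-at i j w p with p ≡ᵇ i | p ≡ᵇ j
... | true | _ = refl
... | false | true = refl
... | false | false = refl

InRange : ℕ → List ℕ → Set
InRange i w = 1 ≤ i × i ≤ length w

at-swapPos : ∀ i j w → InRange i w → InRange j w → ∀ p → at (swapPos i j w) p ≡ at w (τ i j p)
at-swapPos i j w (i1 , il) (j1 , jl) zero rewrite at-zero (swapPos i j w) | ≢⇒≡ᵇ-false 0 i (<⇒≢ i1)
    | ≢⇒≡ᵇ-false 0 j (<⇒≢ j1) = sym (at-zero w)
at-swapPos i j w (i1 , il) (j1 , jl) (suc r) with r <? length w
... | yes lt rewrite swapPos≡swapFrom i j w | at-swapFrom i j w 1 w r lt = swapEntry-at i j w (suc r)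
... | no ge rewrite swapPos≡swapFrom i j w
      | at-beyond (swapFrom i j w 1 w) r (subst (_≤ r) (sym (length-swapFrom i j w 1 w)) (≮⇒≥ ge))
      | τ-fixed i j (suc r) (λ e → ge (subst (_≤ length w) (sym e) il)) (λ e → ge (subst (_≤ length w) (sym e) jl))
      = sym (at-beyond w r (≮⇒≥ ge))

at-swapPos-left : ∀ i j x → InRange i x → InRange j x → at (swapPos i j x) i ≡ at x j
at-swapPos-left i j x ri rj = trans (at-swapPos i j x ri rj i) (cong (at x) (τ-left i j))

at-swapPos-right : ∀ i j x → InRange i x → InRange j x → i ≢ j → at (swapPos i j x) j ≡ at x i
at-swapPos-right i j x ri rj i≢j = trans (at-swapPos i j x ri rj j) (cong (at x) (τ-right i j i≢j))

at-swapPos-fixed : ∀ i j x → InRange i x → InRange j x → ∀ p → p ≢ i → p ≢ j → at (swapPos i j x) p ≡ at x p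
at-swapPos-fixed i j x ri rj p p≢i p≢j = trans (at-swapPos i j x ri rj p) (cong (at x) (τ-fixed i j p p≢i p≢j))

at-ext : ∀ u v → length u ≡ length v → (∀ p → at u p ≡ at v p) → u ≡ v
at-ext [] [] e h = refl
at-ext (x ∷ u) (y ∷ v) e h = cong₂ _∷_ (h 1) (at-ext u v (suc-injective e) h')
  where
  h' : ∀ p → at u p ≡ at v p
  h' zero = trans (at-zero u) (sym (at-zero v))
  h' (suc p) = h (suc (suc p))

InRange-swapPos : ∀ p i j x → InRange p x → InRange p (swapPos i j x)
InRange-swapPos p i j x (a , b) = a , subst (p ≤_) (sym (length-swapPos i j x)) b

InRange-τ : ∀ i j p x → InRange i x → InRange j x → InRange p x → InRange (τ i j p) x
InRange-τ i j p x ri rj rp with p ≟ i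
... | yes refl rewrite τ-left p j = rj
... | no n1 with p ≟ j
...   | yes refl rewrite τ-right i p (≢-sym n1) = ri
...   | no n2 rewrite τ-fixed i j p n1 n2 = rp

InRange-resp-length : ∀ p x y → length x ≡ length y → InRange p x → InRange p y
InRange-resp-length p x y e (a , b) = a , subst (p ≤_) e b

swapPos-involutive : ∀ i j u → InRange i u → InRange j u → swapPos i j (swapPos i j u) ≡ u
swapPos-involutive i j u ri rj = at-ext (swapPos i j (swapPos i j u)) u
    (trans (length-swapPos i j (swapPos i j u)) (length-swapPos i j u)) h
  where
  h : ∀ p → at (swapPos i j (swapPos i j u)) p ≡ at u p
  h p rewrite at-swapPos i j (swapPos i j u) (InRange-swapPos i i j u ri) (InRange-swapPos j i j u rj) p
      | at-swapPos i j u ri rj (τ i j p) | τ-involutive i j p = refl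

DistinctEntries : List ℕ → Set
DistinctEntries x = ∀ p q → InRange p x → InRange q x → p ≢ q → at x p ≢ at x q

DistinctEntries-swapPos : ∀ i j x → InRange i x → InRange j x → DistinctEntries x → DistinctEntries (swapPos i j x)
DistinctEntries-swapPos i j x ri rj d p q rp rq pq e =
  d (τ i j p) (τ i j q) (InRange-τ i j p x ri rj (InRange-resp-length p (swapPos i j x) x (length-swapPos i j x) rp))
      (InRange-τ i j q x ri rj (InRange-resp-length q (swapPos i j x) x (length-swapPos i j x) rq))
    (λ h → pq (τ-injective i j p q h))
    (trans (sym (at-swapPos i j x ri rj p)) (trans e (at-swapPos i j x ri rj q)))

at-applyUpTo : ∀ (f : ℕ → ℕ) m r → r < m → at (applyUpTo f m) (suc r) ≡ f r
at-applyUpTo f (suc m) zero lt = refl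
at-applyUpTo f (suc (suc m)) (suc r) (s≤s lt) = at-applyUpTo (λ z → f (suc z)) (suc m) r lt

at-∷ : ∀ y x m → 1 ≤ m → at (y ∷ x) (suc m) ≡ at x m
at-∷ y x (suc m) _ = refl

Linked-at : ∀ v → (∀ a → 1 ≤ a → suc a ≤ length v → at v a ≤ at v (suc a)) → Linked _≤_ v
Linked-at [] h = []
Linked-at (x ∷ []) h = [-]
Linked-at (x ∷ y ∷ r) h = h 1 (s≤s z≤n) (s≤s (s≤s z≤n)) ∷ Linked-at (y ∷ r) h'
  where
  h' : ∀ a → 1 ≤ a → suc a ≤ length (y ∷ r) → at (y ∷ r) a ≤ at (y ∷ r) (suc a)
  h' (suc a) a1 al = h (suc (suc a)) (s≤s z≤n) (s≤s al)

Repetitionless : List ℕ → Set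
Repetitionless [] = ⊤
Repetitionless (a ∷ ρ) = a ∉ ρ × Repetitionless ρ

Repetitionless-middle : ∀ xs a ys → Repetitionless (xs ++ a ∷ ys) → a ∉ xs
Repetitionless-middle (x ∷ xs) a ys (nx , d) (here refl) = nx (∈-++⁺ʳ xs (here refl))
Repetitionless-middle (x ∷ xs) a ys (nx , d) (there m) = Repetitionless-middle xs a ys d m

∈⇒∷⊑-++ : ∀ {b : ℕ} {ys zs} xs → b ∈ xs → ys ⊑ zs → (b ∷ ys) ⊑ xs ++ zs
∈⇒∷⊑-++ (x ∷ xs) (here refl) s = refl ∷ ++⁺ˡ xs s
∈⇒∷⊑-++ (x ∷ xs) (there m) s = x ∷ʳ ∈⇒∷⊑-++ xs m s

subword-dec : ∀ ρ (Q : List ℕ → Set) → (∀ σ → Dec (Q σ)) → Dec (Σ (List ℕ) λ σ → σ ⊑ ρ × Q σ)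
subword-dec [] Q d with d []
... | yes q = yes ([] , [] , q)
... | no q = no λ { (.[] , [] , r) → q r }
subword-dec (a ∷ ρ) Q d with subword-dec ρ Q d | subword-dec ρ (λ σ → Q (a ∷ σ)) (λ σ → d (a ∷ σ))
... | yes (σ , s , q) | _ = yes (σ , a ∷ʳ s , q)
... | no _ | yes (σ , s , q) = yes (a ∷ σ , refl ∷ s , q)
... | no h1 | no h2 = no λ { (σ , (.a ∷ʳ s) , q) → h1 (σ , s , q) ; ((.a ∷ σ) , (refl ∷ s) , q) → h2 (σ , s , q) }

swapAdj : ℕ → List ℕ → List ℕ
swapAdj a x = swapPos a (suc a) x

length-swapAdj : ∀ a x → length (swapAdj a x) ≡ length x
length-swapAdj a x = length-swapPos a (suc a) x

Ascent : ℕ → List ℕ → Set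
Ascent a x = at x a < at x (suc a)

Descent : ℕ → List ℕ → Set
Descent a x = at x (suc a) < at x a

AdjInRange : ℕ → List ℕ → Set
AdjInRange a x = 1 ≤ a × suc a ≤ length x

AdjInRange-left : ∀ a x → AdjInRange a x → InRange a x
AdjInRange-left a x (a1 , al) = a1 , ≤-trans (n≤1+n _) al

AdjInRange-right : ∀ a x → AdjInRange a x → InRange (suc a) x
AdjInRange-right a x (a1 , al) = s≤s z≤n , al

AdjInRange-resp-length : ∀ a x y → length x ≡ length y → AdjInRange a x → AdjInRange a y
AdjInRange-resp-length a x y e (p , q) = p , subst (suc a ≤_) e q

AdjInRange-swapPos : ∀ a i j x → AdjInRange a x → AdjInRange a (swapPos i j x)
AdjInRange-swapPos a i j x = AdjInRange-resp-length a x (swapPos i j x) (sym (length-swapPos i j x))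

ascent⊎descent : ∀ a x → DistinctEntries x → AdjInRange a x → Ascent a x ⊎ Descent a x
ascent⊎descent a x d r with <-cmp (at x a) (at x (suc a))
... | tri< lt _ _ = inj₁ lt
... | tri≈ _ eq _ = ⊥-elim (d a (suc a) (AdjInRange-left a x r) (AdjInRange-right a x r) (λ e → n≢1+n a e) eq)
... | tri> _ _ gt = inj₂ gt

at-swapAdj-left : ∀ a x → AdjInRange a x → at (swapAdj a x) a ≡ at x (suc a)
at-swapAdj-left a x r rewrite at-swapPos a (suc a) x (AdjInRange-left a x r) (AdjInRange-right a x r) a
    | τ-left a (suc a) = refl

at-swapAdj-right : ∀ a x → AdjInRange a x → at (swapAdj a x) (suc a) ≡ at x a
at-swapAdj-right a x r rewrite at-swapPos a (suc a) x (AdjInRange-left a x r) (AdjInRange-right a x r) (suc a)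
    | τ-right a (suc a) (n≢1+n a) = refl

swapAdj-involutive : ∀ a x → AdjInRange a x → swapAdj a (swapAdj a x) ≡ x
swapAdj-involutive a x r = swapPos-involutive a (suc a) x (AdjInRange-left a x r) (AdjInRange-right a x r)

ascent⇒descent-swapAdj : ∀ a x → AdjInRange a x → Ascent a x → Descent a (swapAdj a x)
ascent⇒descent-swapAdj a x r h rewrite at-swapAdj-left a x r | at-swapAdj-right a x r = h

descent⇒ascent-swapAdj : ∀ a x → AdjInRange a x → Descent a x → Ascent a (swapAdj a x)
descent⇒ascent-swapAdj a x r h rewrite at-swapAdj-left a x r | at-swapAdj-right a x r = h

swapAdj-∷ : ∀ a y x → 1 ≤ a → suc a ≤ length x → swapAdj (suc a) (y ∷ x) ≡ y ∷ swapAdj a x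
swapAdj-∷ a y x a1 al = at-ext _ _ (trans (length-swapPos (suc a) (suc (suc a)) (y ∷ x))
    (cong suc (sym (length-swapAdj a x)))) h
  where
  ra : InRange (suc a) (y ∷ x)
  ra = s≤s z≤n , s≤s (≤-trans (n≤1+n a) al)
  rb : InRange (suc (suc a)) (y ∷ x)
  rb = s≤s z≤n , s≤s al
  h : ∀ p → at (swapAdj (suc a) (y ∷ x)) p ≡ at (y ∷ swapAdj a x) p
  h zero = trans (at-zero (swapAdj (suc a) (y ∷ x))) (sym (at-zero (y ∷ swapAdj a x)))
  h (suc zero) rewrite at-swapPos (suc a) (suc (suc a)) (y ∷ x) ra rb 1
    | τ-fixed (suc a) (suc (suc a)) 1 (λ e → <-irrefl (suc-injective e) a1) (λ ()) = refl
  h (suc (suc r)) rewrite at-swapPos (suc a) (suc (suc a)) (y ∷ x) ra rb (suc (suc r)) | τ-suc a (suc a) (suc r)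
    | at-swapPos a (suc a) x (a1 , ≤-trans (n≤1+n a) al) (s≤s z≤n , al) (suc r)
    = at-∷ y x (τ a (suc a) (suc r)) (τ-nonzero a (suc a) (suc r) a1 (s≤s z≤n) (s≤s z≤n))

swapAdj-1 : ∀ y z r → swapAdj 1 (y ∷ z ∷ r) ≡ z ∷ y ∷ r
swapAdj-1 y z r = at-ext _ _ (length-swapPos 1 2 (y ∷ z ∷ r)) h
  where
  h : ∀ p → at (swapAdj 1 (y ∷ z ∷ r)) p ≡ at (z ∷ y ∷ r) p
  h zero = trans (at-zero (swapAdj 1 (y ∷ z ∷ r))) (sym (at-zero (z ∷ y ∷ r)))
  h (suc p) rewrite at-swapPos 1 2 (y ∷ z ∷ r) (s≤s z≤n , s≤s z≤n) (s≤s z≤n , s≤s (s≤s z≤n)) (suc p) with p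
  ... | zero = refl
  ... | suc zero = refl
  ... | suc (suc q) = refl

swapAdj-↭ : ∀ a v → AdjInRange a v → swapAdj a v ↭ v
swapAdj-↭ (suc zero) (p ∷ []) (_ , s≤s ())
swapAdj-↭ (suc zero) (p ∷ q ∷ r) _ = subst (_↭ (p ∷ q ∷ r)) (sym (swapAdj-1 p q r)) (swap q p ↭-refl)
swapAdj-↭ (suc (suc a)) (p ∷ v) (_ , s≤s al) = subst (_↭ (p ∷ v)) (sym (swapAdj-∷ (suc a) p v (s≤s z≤n) al))
    (prep p (swapAdj-↭ (suc a) v (s≤s z≤n , al)))

swapAdj-commute : ∀ a b x → AdjInRange a x → AdjInRange b x → b ≢ a → suc b ≢ a → b ≢ suc a →
    swapAdj a (swapAdj b x) ≡ swapAdj b (swapAdj a x)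
swapAdj-commute a b x ra rb ba sba bsa = at-ext _ _
    (trans (length-swapAdj a (swapAdj b x)) (trans (length-swapAdj b x)
    (trans (sym (length-swapAdj a x)) (sym (length-swapAdj b (swapAdj a x)))))) h
  where
  h : ∀ p → at (swapAdj a (swapAdj b x)) p ≡ at (swapAdj b (swapAdj a x)) p
  h p rewrite at-swapPos a (suc a) (swapAdj b x) (InRange-swapPos a b (suc b) x (AdjInRange-left a x ra))
      (InRange-swapPos (suc a) b (suc b) x (AdjInRange-right a x ra)) p
            | at-swapPos b (suc b) x (AdjInRange-left b x rb) (AdjInRange-right b x rb) (τ a (suc a) p)
            | at-swapPos b (suc b) (swapAdj a x) (InRange-swapPos b a (suc a) x (AdjInRange-left b x rb))
                (InRange-swapPos (suc b) a (suc a) x (AdjInRange-right b x rb)) p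
            | at-swapPos a (suc a) x (AdjInRange-left a x ra) (AdjInRange-right a x ra) (τ b (suc b) p)
            = cong (at x) (τ-commute b (suc b) a (suc a) p ba bsa sba (λ q → ba (suc-injective q)))

Far : ℕ → ℕ → Set
Far a b = b ≢ a × suc b ≢ a × b ≢ suc a

-- Bruhat steps and the lifting property

mkBStep : ∀ u i j → 1 ≤ i → i < j → j ≤ length u → at u i < at u j → BStep u (swapPos i j u)
mkBStep u i j a b c d = i , j , a , b , c , d , refl

length-BStep : ∀ {u v} → BStep u v → length v ≡ length u
length-BStep {u} (i , j , _ , _ , _ , _ , refl) = length-swapPos i j u

length-≤B : ∀ {u v} → u ≤B v → length u ≡ length v
length-≤B ε = refl
length-≤B (s ◅ r) = trans (sym (length-BStep s)) (length-≤B r)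

AdjInRange-≤B⁻ : ∀ {a x y} → AdjInRange a y → x ≤B y → AdjInRange a x
AdjInRange-≤B⁻ {a} {x} {y} r x≤y = AdjInRange-resp-length a y x (sym (length-≤B x≤y)) r

BStep-InRange : ∀ {u i j} → 1 ≤ i → i < j → j ≤ length u → InRange i u × InRange j u
BStep-InRange {u} {i} {j} a b c = (a , ≤-trans (<⇒≤ b) c) , (≤-trans a (<⇒≤ b) , c)

DistinctEntries-BStep⁻ : ∀ {u v} → BStep u v → DistinctEntries v → DistinctEntries u
DistinctEntries-BStep⁻ {u} (i , j , a , b , c , d , refl) dv =
  subst DistinctEntries (swapPos-involutive i j u ri rj)
      (DistinctEntries-swapPos i j (swapPos i j u) (InRange-swapPos i i j u ri) (InRange-swapPos j i j u rj) dv)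
  where
  ri = proj₁ (BStep-InRange {u} a b c)
  rj = proj₂ (BStep-InRange {u} a b c)

DistinctEntries-≤B⁻ : ∀ {u v} → u ≤B v → DistinctEntries v → DistinctEntries u
DistinctEntries-≤B⁻ ε d = d
DistinctEntries-≤B⁻ (s ◅ r) d = DistinctEntries-BStep⁻ s (DistinctEntries-≤B⁻ r d)

ascent⇒BStep : ∀ a x → AdjInRange a x → Ascent a x → BStep x (swapAdj a x)
ascent⇒BStep a x r h = mkBStep x a (suc a) (proj₁ r) ≤-refl (proj₂ r) h

swapAdj-BStep : ∀ a x i j → AdjInRange a x → 1 ≤ i → i < j → j ≤ length x → at x i < at x j →
  ¬ (i ≡ a × j ≡ suc a) → BStep (swapAdj a x) (swapAdj a (swapPos i j x))
swapAdj-BStep a x i j r i1 ij jl v nn =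
  τ a (suc a) i , τ a (suc a) j , proj₁ ri' , τ-adjacent-mono a i j ij nn ,
  subst (τ a (suc a) j ≤_) (sym (length-swapAdj a x)) (proj₂ rj') , v' , eq
  where
  ra = AdjInRange-left a x r
  rb = AdjInRange-right a x r
  ri = proj₁ (BStep-InRange {x} i1 ij jl)
  rj = proj₂ (BStep-InRange {x} i1 ij jl)
  ri' = InRange-τ a (suc a) i x ra rb ri
  rj' = InRange-τ a (suc a) j x ra rb rj
  v' : at (swapAdj a x) (τ a (suc a) i) < at (swapAdj a x) (τ a (suc a) j)
  v' rewrite at-swapPos a (suc a) x ra rb (τ a (suc a) i) | at-swapPos a (suc a) x ra rb (τ a (suc a) j)
           | τ-involutive a (suc a) i | τ-involutive a (suc a) j = v
  ij≢ : i ≢ j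
  ij≢ e = <-irrefl e ij
  eq : swapAdj a (swapPos i j x) ≡ swapPos (τ a (suc a) i) (τ a (suc a) j) (swapAdj a x)
  eq = at-ext _ _ (trans (length-swapAdj a (swapPos i j x))
      (trans (length-swapPos i j x) (trans (sym (length-swapAdj a x)) (sym (length-swapPos _ _ (swapAdj a x)))))) h
    where
    h : ∀ p → at (swapAdj a (swapPos i j x)) p ≡ at (swapPos (τ a (suc a) i) (τ a (suc a) j) (swapAdj a x)) p
    h p rewrite at-swapPos a (suc a) (swapPos i j x) (InRange-swapPos a i j x ra) (InRange-swapPos (suc a) i j x rb) p
              | at-swapPos i j x ri rj (τ a (suc a) p)
              | at-swapPos (τ a (suc a) i) (τ a (suc a) j) (swapAdj a x) (InRange-swapPos _ a (suc a) x ri')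
                  (InRange-swapPos _ a (suc a) x rj') p
              | at-swapPos a (suc a) x ra rb (τ (τ a (suc a) i) (τ a (suc a) j) p)
              = cong (at x) (sym (trans (cong (λ q → τ a (suc a) (τ (τ a (suc a) i) (τ a (suc a) j) q))
                  (sym (τ-involutive a (suc a) p))) (τ-conjugate a (suc a) i j (τ a (suc a) p) ij≢)))

-- The chains x sₐ < x sₐ (a j) < x sₐ (a j) (a+1 j) = x (a j)
-- and x < x (a+1 j) < x (a+1 j) (a j) = x (a j) sₐ.
BStep-past-ascentʳ : ∀ a x j → AdjInRange a x → suc a < j → j ≤ length x → Ascent a x → at x (suc a) < at x j →
  (swapAdj a x ≤B swapPos a j x) × (x ≤B swapAdj a (swapPos a j x))
BStep-past-ascentʳ a x j r aj jl ax v = (step₁ ◅ subst (BStep y₁) y₂≡ step₂ ◅ ε) , (step₃ ◅ subst (BStep z₁) z₂≡ step₄ ◅ ε)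
  where
  ra = AdjInRange-left a x r
  rb = AdjInRange-right a x r
  rj = (≤-trans (s≤s z≤n) aj , jl)
  ja : j ≢ a
  ja e = <-asym (subst (suc a <_) e aj) (n<1+n a)
  jb : j ≢ suc a
  jb e = <-irrefl (sym e) aj
  xsₐ = swapAdj a x
  length-xsₐ = length-swapAdj a x
  y₁ = swapPos a j xsₐ
  y₂ = swapPos (suc a) j y₁
  a<j = <-trans (n<1+n a) aj
  lt₁ : at xsₐ a < at xsₐ j
  lt₁ rewrite at-swapAdj-left a x r | at-swapPos a (suc a) x ra rb j | τ-fixed a (suc a) j ja jb = v
  step₁ : BStep xsₐ y₁
  step₁ = mkBStep xsₐ a j (proj₁ r) a<j (subst (j ≤_) (sym length-xsₐ) jl) lt₁
  rxa = InRange-swapPos a a (suc a) x ra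
  rxj = InRange-swapPos j a (suc a) x rj
  lt₂ : at y₁ (suc a) < at y₁ j
  lt₂ rewrite at-swapPos a j xsₐ rxa rxj (suc a) | at-swapPos a j xsₐ rxa rxj j | τ-fixed a j (suc a) 1+n≢n (≢-sym jb)
      | τ-right a j (≢-sym ja)
           | at-swapAdj-left a x r | at-swapAdj-right a x r = ax
  step₂ : BStep y₁ y₂
  step₂ = mkBStep y₁ (suc a) j (s≤s z≤n) aj (subst (j ≤_) (sym (trans (length-swapPos a j xsₐ) length-xsₐ)) jl) lt₂
  y₂≡ : y₂ ≡ swapPos a j x
  y₂≡ = at-ext _ _ (trans (length-swapPos (suc a) j y₁)
      (trans (length-swapPos a j xsₐ) (trans length-xsₐ (sym (length-swapPos a j x))))) h
    where
    h : ∀ p → at y₂ p ≡ at (swapPos a j x) p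
    h p rewrite at-swapPos (suc a) j y₁ (InRange-swapPos (suc a) a j xsₐ (InRange-swapPos (suc a) a (suc a) x rb))
        (InRange-swapPos j a j xsₐ rxj) p
              | at-swapPos a j xsₐ rxa rxj (τ (suc a) j p)
              | at-swapPos a (suc a) x ra rb (τ a j (τ (suc a) j p))
              | at-swapPos a j x ra rj p = cong (at x) (τ-braidʳ₁ a j p ja jb)
  z₁ = swapPos (suc a) j x
  z₂ = swapPos a j z₁
  step₃ : BStep x z₁
  step₃ = mkBStep x (suc a) j (s≤s z≤n) aj jl v
  lt₃ : at z₁ a < at z₁ j
  lt₃ rewrite at-swapPos (suc a) j x rb rj a | at-swapPos (suc a) j x rb rj j | τ-fixed (suc a) j a (n≢1+n a) (≢-sym ja)
      | τ-right (suc a) j (≢-sym jb) = ax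
  step₄ : BStep z₁ z₂
  step₄ = mkBStep z₁ a j (proj₁ r) a<j (subst (j ≤_) (sym (length-swapPos (suc a) j x)) jl) lt₃
  z₂≡ : z₂ ≡ swapAdj a (swapPos a j x)
  z₂≡ = at-ext _ _ (trans (length-swapPos a j z₁) (trans (length-swapPos (suc a) j x)
      (sym (trans (length-swapAdj a (swapPos a j x)) (length-swapPos a j x))))) h
    where
    h : ∀ p → at z₂ p ≡ at (swapAdj a (swapPos a j x)) p
    h p rewrite at-swapPos a j z₁ (InRange-swapPos a (suc a) j x ra) (InRange-swapPos j (suc a) j x rj) p
              | at-swapPos (suc a) j x rb rj (τ a j p)
              | at-swapPos a (suc a) (swapPos a j x) (InRange-swapPos a a j x ra) (InRange-swapPos (suc a) a j x rb) p
              | at-swapPos a j x ra rj (τ a (suc a) p) = cong (at x) (τ-braidʳ₂ a j p ja jb)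

-- The chains x sₐ < x sₐ (i a+1) < x sₐ (i a+1) (i a) = x (i a+1)
-- and x < x (i a) < x (i a) (i a+1) = x (i a+1) sₐ.
BStep-past-ascentˡ : ∀ a x i → AdjInRange a x → 1 ≤ i → i < a → Ascent a x → at x i < at x a →
  (swapAdj a x ≤B swapPos i (suc a) x) × (x ≤B swapAdj a (swapPos i (suc a) x))
BStep-past-ascentˡ a x i r i1 ia ax v = (step₁ ◅ subst (BStep y₁) y₂≡ step₂ ◅ ε) , (step₃ ◅ subst (BStep z₁) z₂≡ step₄ ◅ ε)
  where
  ra = AdjInRange-left a x r
  rb = AdjInRange-right a x r
  ri = (i1 , ≤-trans (<⇒≤ ia) (proj₂ ra))
  ia≢ : i ≢ a
  ia≢ e = <-irrefl e ia
  ib≢ : i ≢ suc a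
  ib≢ e = <-asym ia (subst (a <_) (sym e) (n<1+n a))
  xsₐ = swapAdj a x
  length-xsₐ = length-swapAdj a x
  y₁ = swapPos i (suc a) xsₐ
  y₂ = swapPos i a y₁
  i<b = <-trans ia (n<1+n a)
  lt₁ : at xsₐ i < at xsₐ (suc a)
  lt₁ rewrite at-swapAdj-right a x r | at-swapPos a (suc a) x ra rb i | τ-fixed a (suc a) i ia≢ ib≢ = v
  step₁ : BStep xsₐ y₁
  step₁ = mkBStep xsₐ i (suc a) i1 i<b (subst (suc a ≤_) (sym length-xsₐ) (proj₂ r)) lt₁
  rxi = InRange-swapPos i a (suc a) x ri
  rxb = InRange-swapPos (suc a) a (suc a) x rb
  rxa = InRange-swapPos a a (suc a) x ra
  lt₂ : at y₁ i < at y₁ a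
  lt₂ rewrite at-swapPos i (suc a) xsₐ rxi rxb i | at-swapPos i (suc a) xsₐ rxi rxb a | τ-left i (suc a)
      | τ-fixed i (suc a) a (≢-sym ia≢) (n≢1+n a)
           | at-swapAdj-left a x r | at-swapAdj-right a x r = ax
  step₂ : BStep y₁ y₂
  step₂ = mkBStep y₁ i a i1 ia (subst (a ≤_) (sym (trans (length-swapPos i (suc a) xsₐ) length-xsₐ)) (proj₂ ra)) lt₂
  y₂≡ : y₂ ≡ swapPos i (suc a) x
  y₂≡ = at-ext _ _ (trans (length-swapPos i a y₁) (trans (length-swapPos i (suc a) xsₐ)
      (trans length-xsₐ (sym (length-swapPos i (suc a) x))))) h
    where
    h : ∀ p → at y₂ p ≡ at (swapPos i (suc a) x) p
    h p rewrite at-swapPos i a y₁ (InRange-swapPos i i (suc a) xsₐ rxi) (InRange-swapPos a i (suc a) xsₐ rxa) p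
              | at-swapPos i (suc a) xsₐ rxi rxb (τ i a p)
              | at-swapPos a (suc a) x ra rb (τ i (suc a) (τ i a p))
              | at-swapPos i (suc a) x ri rb p = cong (at x) (τ-braidˡ₁ a i p ia≢ ib≢)
  z₁ = swapPos i a x
  z₂ = swapPos i (suc a) z₁
  step₃ : BStep x z₁
  step₃ = mkBStep x i a i1 ia (proj₂ ra) v
  lt₃ : at z₁ i < at z₁ (suc a)
  lt₃ rewrite at-swapPos i a x ri ra i | at-swapPos i a x ri ra (suc a) | τ-left i a
      | τ-fixed i a (suc a) (≢-sym ib≢) 1+n≢n = ax
  step₄ : BStep z₁ z₂
  step₄ = mkBStep z₁ i (suc a) i1 i<b (subst (suc a ≤_) (sym (length-swapPos i a x)) (proj₂ r)) lt₃
  z₂≡ : z₂ ≡ swapAdj a (swapPos i (suc a) x)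
  z₂≡ = at-ext _ _ (trans (length-swapPos i (suc a) z₁)
      (trans (length-swapPos i a x) (sym (trans (length-swapAdj a (swapPos i (suc a) x))
      (length-swapPos i (suc a) x))))) h
    where
    h : ∀ p → at z₂ p ≡ at (swapAdj a (swapPos i (suc a) x)) p
    h p rewrite at-swapPos i (suc a) z₁ (InRange-swapPos i i a x ri) (InRange-swapPos (suc a) i a x rb) p
              | at-swapPos i a x ri ra (τ i (suc a) p)
              | at-swapPos a (suc a) (swapPos i (suc a) x) (InRange-swapPos a i (suc a) x ra)
                  (InRange-swapPos (suc a) i (suc a) x rb) p
              | at-swapPos i (suc a) x ri rb (τ a (suc a) p) = cong (at x) (τ-braidˡ₂ a i p ia≢ ib≢)

BStep-past-ascent : ∀ a x i j → AdjInRange a x → 1 ≤ i → i < j → j ≤ length x → at x i < at x j →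
  Ascent a x → Descent a (swapPos i j x) →
  (swapAdj a x ≤B swapPos i j x) × (x ≤B swapAdj a (swapPos i j x))
BStep-past-ascent a x i j r i1 ij jl v ax dy with i ≟ a
... | yes refl with j ≟ suc i
...   | yes refl = ε , subst (x ≤B_) (sym (swapAdj-involutive i x r)) ε
...   | no j≢1+i = BStep-past-ascentʳ i x j r (≤∧≢⇒< ij (≢-sym j≢1+i)) jl ax
        (subst₂ _<_ (at-swapPos-fixed i j x ri rj (suc i) 1+n≢n (≢-sym j≢1+i)) (at-swapPos-left i j x ri rj) dy)
  where
  ri = proj₁ (BStep-InRange {x} i1 ij jl)
  rj = proj₂ (BStep-InRange {x} i1 ij jl)
BStep-past-ascent a x i j r i1 ij jl v ax dy | no i≢a with i ≟ suc a
...   | yes refl = ⊥-elim (<-asym (<-trans ax v)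
        (subst₂ _<_ (at-swapPos-left i j x ri rj) (at-swapPos-fixed i j x ri rj a (n≢1+n a)
            (<⇒≢ (<-trans (n<1+n a) ij))) dy))
  where
  ri = proj₁ (BStep-InRange {x} i1 ij jl)
  rj = proj₂ (BStep-InRange {x} i1 ij jl)
...   | no i≢1+a with j ≟ a
...     | yes refl = ⊥-elim (<-asym (<-trans v ax)
          (subst₂ _<_ (at-swapPos-fixed i j x ri rj (suc j) (≢-sym (<⇒≢ (<-trans ij (n<1+n j)))) 1+n≢n)
              (at-swapPos-right i j x ri rj (<⇒≢ ij)) dy))
  where
  ri = proj₁ (BStep-InRange {x} i1 ij jl)
  rj = proj₂ (BStep-InRange {x} i1 ij jl)
...     | no j≢a with j ≟ suc a
...       | yes refl = BStep-past-ascentˡ a x i r i1 (≤∧≢⇒< (≤-pred ij) i≢a) ax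
            (subst₂ _<_ (at-swapPos-right i j x ri rj (<⇒≢ ij)) (at-swapPos-fixed i j x ri rj a (≢-sym i≢a) (n≢1+n a))
                dy)
  where
  ri = proj₁ (BStep-InRange {x} i1 ij jl)
  rj = proj₂ (BStep-InRange {x} i1 ij jl)
...       | no j≢1+a = ⊥-elim (<-asym ax
            (subst₂ _<_ (at-swapPos-fixed i j x ri rj (suc a) (≢-sym i≢1+a) (≢-sym j≢1+a))
                (at-swapPos-fixed i j x ri rj a (≢-sym i≢a) (≢-sym j≢a)) dy))
  where
  ri = proj₁ (BStep-InRange {x} i1 ij jl)
  rj = proj₂ (BStep-InRange {x} i1 ij jl)

descent⇒BStep : ∀ a x → AdjInRange a x → Descent a x → BStep (swapAdj a x) x
descent⇒BStep a x r d = subst (BStep (swapAdj a x)) (swapAdj-involutive a x r)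
    (ascent⇒BStep a (swapAdj a x) (AdjInRange-swapPos a a (suc a) x r)
    (descent⇒ascent-swapAdj a x r d))

-- Induction along the chain x → ⋯ → w: its first step x → x (i j) either commutes with sₐ
-- (swapAdj-BStep) or crosses the ascent of x at a (BStep-past-ascent).
mutual
  lifting : ∀ a {x w} → x ≤B w → DistinctEntries w → AdjInRange a w → Ascent a x → Descent a w →
      (swapAdj a x ≤B w) × (x ≤B swapAdj a w)
  lifting a ε dw r ax dw' = ⊥-elim (<-asym ax dw')
  lifting a {x} {w} ((i , j , i1 , ij , jl , v , refl) ◅ rest) dw r ax dwa
    with ascent⊎descent a (swapPos i j x) (DistinctEntries-≤B⁻ rest dw)
        (AdjInRange-≤B⁻ r rest)
  ... | inj₁ ay = (st ◅ proj₁ p) , ((i , j , i1 , ij , jl , v , refl) ◅ proj₂ p)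
    where
    p = lifting a rest dw r ay dwa
    rx : AdjInRange a x
    rx = AdjInRange-≤B⁻ r (mkBStep x i j i1 ij jl v ◅ rest)
    nn : ¬ (i ≡ a × j ≡ suc a)
    nn (refl , refl) = <-asym ay (ascent⇒descent-swapAdj i x rx ax)
    st = swapAdj-BStep a x i j rx i1 ij jl v nn
  ... | inj₂ dy = (proj₁ q ◅◅ rest) , (proj₂ q ◅◅ lifting-descents a rest dw r dy dwa)
    where
    rx : AdjInRange a x
    rx = AdjInRange-≤B⁻ r (mkBStep x i j i1 ij jl v ◅ rest)
    q = BStep-past-ascent a x i j rx i1 ij jl v ax dy

  lifting-descents : ∀ a {x w} → x ≤B w → DistinctEntries w → AdjInRange a w → Descent a x → Descent a w →
      swapAdj a x ≤B swapAdj a w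
  lifting-descents a ε dw r dx dwa = ε
  lifting-descents a {x} {w} ((i , j , i1 , ij , jl , v , refl) ◅ rest) dw r dx dwa
    with ascent⊎descent a (swapPos i j x) (DistinctEntries-≤B⁻ rest dw)
        (AdjInRange-≤B⁻ r rest)
  ... | inj₂ dy = swapAdj-BStep a x i j rx i1 ij jl v nn ◅ lifting-descents a rest dw r dy dwa
    where
    rx : AdjInRange a x
    rx = AdjInRange-≤B⁻ r (mkBStep x i j i1 ij jl v ◅ rest)
    nn : ¬ (i ≡ a × j ≡ suc a)
    nn (refl , refl) = <-asym dy (descent⇒ascent-swapAdj i x rx dx)
  ... | inj₁ ay = descent⇒BStep a x rx dx ◅ (i , j , i1 , ij , jl , v , refl) ◅ proj₂ (lifting a rest dw r ay dwa)
    where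
    rx : AdjInRange a x
    rx = AdjInRange-≤B⁻ r (mkBStep x i j i1 ij jl v ◅ rest)

lifting-ascents : ∀ a {x w} → x ≤B w → DistinctEntries w → AdjInRange a w → Ascent a x → Ascent a w →
    swapAdj a x ≤B swapAdj a w
lifting-ascents a {x} {w} le dw r ax aw =
  proj₁ (lifting a (le ◅◅ (ascent⇒BStep a w r aw ◅ ε))
      (DistinctEntries-swapPos a (suc a) w (AdjInRange-left a w r) (AdjInRange-right a w r) dw)
    (AdjInRange-swapPos a a (suc a) w r) ax (ascent⇒descent-swapAdj a w r aw))

-- rank x p q counts the positions t ≤ p with x(t) > q; it can only grow along Bruhat
-- steps (the easy half of the tableau criterion for the Bruhat order).
rank : List ℕ → ℕ → ℕ → ℕ
rank x zero q = 0
rank x (suc p) q = rank x p q + indicator (q <ᵇ at x (suc p))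

module RankSwap (x : List ℕ) (i j q : ℕ) (ri : InRange i x) (rj : InRange j x) (ij : i < j) where
  y = swapPos i j x
  g : ℕ → ℕ
  g t = indicator (q <ᵇ at x t)
  gy : ∀ t → indicator (q <ᵇ at y t) ≡ g (τ i j t)
  gy t = cong (λ z → indicator (q <ᵇ z)) (at-swapPos i j x ri rj t)
  gout : ∀ t → t ≢ i → t ≢ j → indicator (q <ᵇ at y t) ≡ g t
  gout t a b = trans (gy t) (cong g (τ-fixed i j t a b))
  Invariant : ℕ → Set
  Invariant p = (p < i → rank y p q ≡ rank x p q) × (i ≤ p → p < j → rank y p q + g i ≡ rank x p q + g j) ×
      (j ≤ p → rank y p q ≡ rank x p q)
  swap3 : ∀ a b c → a + b + c ≡ a + c + b
  swap3 a b c = trans (+-assoc a b c) (trans (cong (a +_) (+-comm b c)) (sym (+-assoc a c b)))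
  invariant : ∀ p → Invariant p
  invariant zero = (λ _ → refl) , (λ a b → ⊥-elim (<-irrefl refl (≤-trans (proj₁ ri) a))) ,
      (λ a → ⊥-elim (<-irrefl refl (≤-trans (≤-trans (proj₁ ri) (<⇒≤ ij)) a)))
  invariant (suc p) with invariant p | <-cmp (suc p) i
  ... | (h1 , h2 , h3) | tri< lt _ _ = (λ _ → trans
        (cong₂ _+_ (h1 (<-trans (n<1+n p) lt)) (gout (suc p) (λ e → <-irrefl e lt) (λ e → <-irrefl e (<-trans lt ij))))
        refl) ,
                                       (λ a _ → ⊥-elim (<-irrefl refl (<-≤-trans lt a))) ,
                                           (λ a → ⊥-elim (<-irrefl refl (<-≤-trans (<-trans lt ij) a)))
  ... | (h1 , h2 , h3) | tri≈ _ eq _ = (λ a → ⊥-elim (<-irrefl eq a)) ,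
       (λ _ _ → trans (cong (_+ g i) (cong₂ _+_ (h1 (subst (p <_) eq (n<1+n p)))
           (trans (gy (suc p)) (cong g (trans (cong (τ i j) eq) (τ-left i j))))))
           (trans (swap3 (rank x p q) (g j) (g i)) (cong (λ z → rank x p q + g z + g j) (sym eq)))) ,
       (λ a → ⊥-elim (<-irrefl refl (<-≤-trans ij (subst (j ≤_) eq a))))
  ... | (h1 , h2 , h3) | tri> _ _ gt with <-cmp (suc p) j
  ...   | tri< lt _ _ = (λ a → ⊥-elim (<-asym a gt)) ,
          (λ _ _ → trans (swap3 (rank y p q) _ (g i))
              (trans (cong₂ _+_ (h2 (≤-pred gt) (<-trans (n<1+n p) lt))
              (gout (suc p) (λ e → <-irrefl (sym e) gt) (λ e → <-irrefl e lt))) (swap3 (rank x p q) (g j) _))) ,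
          (λ a → ⊥-elim (<-irrefl refl (<-≤-trans lt a)))
  ...   | tri≈ _ eq _ = (λ a → ⊥-elim (<-asym a gt)) , (λ _ a → ⊥-elim (<-irrefl eq a)) ,
          (λ _ → trans (cong (rank y p q +_) (trans (gy (suc p))
              (cong g (trans (cong (τ i j) eq) (τ-right i j (λ e → <-irrefl e ij))))))
                   (trans (h2 (≤-pred gt) (subst (p <_) eq (n<1+n p))) (cong (λ z → rank x p q + g z) (sym eq))))
  ...   | tri> _ _ gt2 = (λ a → ⊥-elim (<-asym a gt)) , (λ _ a → ⊥-elim (<-asym a gt2)) ,
          (λ _ → cong₂ _+_ (h3 (≤-pred gt2)) (gout (suc p) (λ e → <-irrefl (sym e) gt) (λ e → <-irrefl (sym e) gt2)))

rank-BStep : ∀ {x y} → BStep x y → ∀ p q → rank x p q ≤ rank y p q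
rank-BStep {x} (i , j , i1 , ij , jl , v , refl) p q with RankSwap.invariant x i j q
    (proj₁ (BStep-InRange {x} i1 ij jl)) (proj₂ (BStep-InRange {x} i1 ij jl)) ij p | p <? i | j ≤? p
... | (h1 , h2 , h3) | yes a | _ = ≤-reflexive (sym (h1 a))
... | (h1 , h2 , h3) | no a | yes b = ≤-reflexive (sym (h3 b))
... | (h1 , h2 , h3) | no a | no b = +-cancelʳ-≤ (indicator (q <ᵇ at x j)) _ _
      (≤-trans (≤-reflexive (sym (h2 (≮⇒≥ a) (≰⇒> b)))) (+-monoʳ-≤ _ (indicator-mono q _ _ v)))

rank-≤B : ∀ {x y} → x ≤B y → ∀ p q → rank x p q ≤ rank y p q
rank-≤B ε p q = ≤-refl
rank-≤B (s ◅ r) p q = ≤-trans (rank-BStep s p q) (rank-≤B r p q)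

act : List ℕ → List ℕ → List ℕ
act [] x = x
act (a ∷ ρ) x = swapAdj a (act ρ x)

act-++ : ∀ ρ σ x → act (ρ ++ σ) x ≡ act ρ (act σ x)
act-++ [] σ x = refl
act-++ (a ∷ ρ) σ x = cong (swapAdj a) (act-++ ρ σ x)

foldl≡act-reverse : ∀ ω x → foldl (λ w a → swapPos a (suc a) w) x ω ≡ act (reverse ω) x
foldl≡act-reverse [] x = refl
foldl≡act-reverse (a ∷ ω) x rewrite unfold-reverse a ω | act-++ (reverse ω) (a ∷ []) x =
    foldl≡act-reverse ω (swapAdj a x)

length-act : ∀ ρ x → length (act ρ x) ≡ length x
length-act [] x = refl
length-act (a ∷ ρ) x = trans (length-swapAdj a (act ρ x)) (length-act ρ x)

countBelow : ℕ → List ℕ → ℕ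
countBelow y L = length (filterᵇ (λ z → z <ᵇ y) L)

countBelow-∷ : ∀ y u L → countBelow y (u ∷ L) ≡ indicator (u <ᵇ y) + countBelow y L
countBelow-∷ y u L with u <ᵇ y
... | true = refl
... | false = refl

countBelow-swapAdj : ∀ y a x → AdjInRange a x → countBelow y (swapAdj a x) ≡ countBelow y x
countBelow-swapAdj y (suc zero) (p ∷ []) (_ , s≤s ())
countBelow-swapAdj y (suc zero) (p ∷ q ∷ r) _ = trans (cong (countBelow y) (swapAdj-1 p q r)) swapped
  where
  swapped : countBelow y (q ∷ p ∷ r) ≡ countBelow y (p ∷ q ∷ r)
  swapped rewrite countBelow-∷ y q (p ∷ r) | countBelow-∷ y p r | countBelow-∷ y p (q ∷ r) | countBelow-∷ y q r
    = trans (sym (+-assoc (indicator (q <ᵇ y)) _ _))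
        (trans (cong (_+ countBelow y r) (+-comm (indicator (q <ᵇ y)) _)) (+-assoc (indicator (p <ᵇ y)) _ _))
countBelow-swapAdj y (suc (suc a)) (p ∷ x) (_ , s≤s al) =
    trans (cong (countBelow y) (swapAdj-∷ (suc a) p x (s≤s z≤n) al)) shifted
  where
  shifted : countBelow y (p ∷ swapAdj (suc a) x) ≡ countBelow y (p ∷ x)
  shifted rewrite countBelow-∷ y p (swapAdj (suc a) x) | countBelow-∷ y p x =
      cong (indicator (p <ᵇ y) +_) (countBelow-swapAdj y (suc a) x (s≤s z≤n , al))

inv-swapAdj : ∀ a x → AdjInRange a x →
  inv (swapAdj a x) + indicator (at x (suc a) <ᵇ at x a) ≡ inv x + indicator (at x a <ᵇ at x (suc a))
inv-swapAdj (suc zero) (p ∷ []) (_ , s≤s ())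
inv-swapAdj (suc zero) (p ∷ q ∷ r) _ = trans (cong (λ z → inv z + indicator (q <ᵇ p)) (swapAdj-1 p q r)) swapped
  where
  swapped : inv (q ∷ p ∷ r) + indicator (q <ᵇ p) ≡ inv (p ∷ q ∷ r) + indicator (p <ᵇ q)
  swapped rewrite countBelow-∷ q p r | countBelow-∷ p q r =
      rearrange (indicator (p <ᵇ q)) (countBelow q r) (countBelow p r) (inv r) (indicator (q <ᵇ p))
    where
    rearrange : ∀ a b c d f → ((a + b) + (c + d)) + f ≡ ((f + c) + (b + d)) + a
    rearrange = solve 5 (λ a b c d f → ((a :+ b) :+ (c :+ d)) :+ f := ((f :+ c) :+ (b :+ d)) :+ a) refl
inv-swapAdj (suc (suc a)) (p ∷ x) (_ , s≤s al) = trans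
    (cong (λ z → inv z + indicator (at x (suc (suc a)) <ᵇ at x (suc a))) (swapAdj-∷ (suc a) p x (s≤s z≤n) al)) shifted
  where
  shifted : inv (p ∷ swapAdj (suc a) x) + indicator (at x (suc (suc a)) <ᵇ at x (suc a)) ≡
        inv (p ∷ x) + indicator (at x (suc a) <ᵇ at x (suc (suc a)))
  shifted rewrite countBelow-swapAdj p (suc a) x (s≤s z≤n , al) =
    trans (+-assoc (countBelow p x) _ _) (trans (cong (countBelow p x +_) (inv-swapAdj (suc a) x (s≤s z≤n , al)))
        (sym (+-assoc (countBelow p x) _ _)))

inv-swapAdj-ascent : ∀ a x → AdjInRange a x → Ascent a x → inv (swapAdj a x) ≡ suc (inv x)
inv-swapAdj-ascent a x r h with inv-swapAdj a x r
... | eq rewrite <⇒<ᵇ-true (at x a) (at x (suc a)) h | ≮⇒<ᵇ-false (at x (suc a)) (at x a) (<-asym h) =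
  trans (sym (+-identityʳ _)) (trans eq (+-comm (inv x) 1))

inv-swapAdj-¬ascent : ∀ a x → AdjInRange a x → ¬ Ascent a x → inv (swapAdj a x) ≤ inv x
inv-swapAdj-¬ascent a x r h with inv-swapAdj a x r
... | eq rewrite ≮⇒<ᵇ-false (at x a) (at x (suc a)) h =
      subst (inv (swapAdj a x) ≤_) (trans eq (+-identityʳ (inv x))) (m≤m+n _ _)

inv-swapAdj-≤ : ∀ a x → AdjInRange a x → inv (swapAdj a x) ≤ suc (inv x)
inv-swapAdj-≤ a x r with at x a <? at x (suc a)
... | yes h = ≤-reflexive (inv-swapAdj-ascent a x r h)
... | no h = ≤-trans (inv-swapAdj-¬ascent a x r h) (n≤1+n _)

countBelow-applyUpTo : ∀ c (g : ℕ → ℕ) m → (∀ t → c < g t) → countBelow c (applyUpTo g m) ≡ 0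
countBelow-applyUpTo c g zero h = refl
countBelow-applyUpTo c g (suc m) h rewrite countBelow-∷ c (g 0) (applyUpTo (λ z → g (suc z)) m)
    | ≮⇒<ᵇ-false (g 0) c (<-asym (h 0)) = countBelow-applyUpTo c (λ z → g (suc z)) m (λ t → h (suc t))

inv-applyUpTo-increasing : ∀ (f : ℕ → ℕ) m → (∀ a b → a < b → f a < f b) → inv (applyUpTo f m) ≡ 0
inv-applyUpTo-increasing f zero h = refl
inv-applyUpTo-increasing f (suc m) h rewrite countBelow-applyUpTo (f 0) (λ z → f (suc z)) m
    (λ t → h 0 (suc t) (s≤s z≤n)) = inv-applyUpTo-increasing (λ z → f (suc z)) m (λ a b lt → h (suc a) (suc b) (s≤s lt))

∷⁺-⊆ : ∀ {m} s (P Q : Subset m) → P ⊆ˢ Q → (s ∷ P) ⊆ˢ (s ∷ Q)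
∷⁺-⊆ s P Q h here = here
∷⁺-⊆ s P Q h (there mem) = there (h mem)

outside∷-⊆ : ∀ {m} t (P Q : Subset m) → P ⊆ˢ Q → (outside ∷ P) ⊆ˢ (t ∷ Q)
outside∷-⊆ t P Q h (there mem) = there (h mem)

∷⁻-⊆ : ∀ {m} s t (P Q : Subset m) → (s ∷ P) ⊆ˢ (t ∷ Q) → P ⊆ˢ Q
∷⁻-⊆ s t P Q h mem with h (there mem)
... | there r = r

inside∷⊈outside∷ : ∀ {m} (P Q : Subset m) → (inside ∷ P) ⊆ˢ (outside ∷ Q) → ⊥
inside∷⊈outside∷ P Q h with h here
... | ()

IsBoolean⇒join : ∀ {u x y} → IsBoolean u → x ≤B u → y ≤B u →
  ∃[ j ] (x ≤B j × y ≤B j × (∀ t → t ≤B u → x ≤B t → y ≤B t → j ≤B t))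
IsBoolean⇒join {u} {x} {y} (m , f , ord , _ , surj) x≤u y≤u with surj (f x x≤u ∪ f y y≤u)
... | j , j≤u , fj = j , x≤j , y≤j , least
  where
  x≤j : x ≤B j
  x≤j = proj₂ (ord x j x≤u j≤u) (λ mem → subst (_ ∈ˢ_) (sym fj) (p⊆p∪q (f y y≤u) mem))
  y≤j : y ≤B j
  y≤j = proj₂ (ord y j y≤u j≤u) (λ mem → subst (_ ∈ˢ_) (sym fj) (q⊆p∪q (f x x≤u) (f y y≤u) mem))
  least : ∀ t → t ≤B u → x ≤B t → y ≤B t → j ≤B t
  least t t≤u x≤t y≤t = proj₂ (ord j t j≤u t≤u) λ mem →
    [ proj₁ (ord x t x≤u t≤u) x≤t , proj₁ (ord y t y≤u t≤u) y≤t ]′ (x∈p∪q⁻ (f x x≤u) (f y y≤u) (subst (_ ∈ˢ_) fj mem))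

module _ (n : ℕ) where

  e : List ℕ
  e = idPerm n

  -- A word acts from its last letter: perm ρ is the product of the reverse of ρ.
  perm : List ℕ → List ℕ
  perm ρ = act ρ e

  prod≡perm-reverse : ∀ ω → prod n ω ≡ perm (reverse ω)
  prod≡perm-reverse ω = foldl≡act-reverse ω e

  length-e : length e ≡ n
  length-e = length-applyUpTo suc n

  length-perm : ∀ ρ → length (perm ρ) ≡ n
  length-perm ρ = trans (length-act ρ e) length-e

  at-e : ∀ p → 1 ≤ p → p ≤ n → at e p ≡ p
  at-e (suc r) _ le = at-applyUpTo suc n r le

  Gen : ℕ → Set
  Gen a = 1 ≤ a × suc a ≤ n

  Reduced : List ℕ → Set
  Reduced [] = ⊤
  Reduced (a ∷ ρ) = Gen a × Ascent a (perm ρ) × Reduced ρ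

  Reduced⇒AllGen : ∀ ρ → Reduced ρ → All Gen ρ
  Reduced⇒AllGen [] _ = []
  Reduced⇒AllGen (a ∷ ρ) (l , _ , i) = l ∷ Reduced⇒AllGen ρ i

  Gen⇒AdjInRange : ∀ a ρ → Gen a → AdjInRange a (perm ρ)
  Gen⇒AdjInRange a ρ (l1 , l2) = l1 , subst (suc a ≤_) (sym (length-perm ρ)) l2

  DistinctEntries-e : DistinctEntries e
  DistinctEntries-e p q (p1 , pl) (q1 , ql) pq eq =
      pq (trans (sym (at-e p p1 (subst (p ≤_) length-e pl))) (trans eq (at-e q q1 (subst (q ≤_) length-e ql))))

  DistinctEntries-perm : ∀ ρ → All Gen ρ → DistinctEntries (perm ρ)
  DistinctEntries-perm [] _ = DistinctEntries-e
  DistinctEntries-perm (a ∷ ρ) (l ∷ al) = DistinctEntries-swapPos a (suc a) (perm ρ)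
      (AdjInRange-left a (perm ρ) (Gen⇒AdjInRange a ρ l)) (AdjInRange-right a (perm ρ) (Gen⇒AdjInRange a ρ l))
      (DistinctEntries-perm ρ al)

  ≤B-e : ∀ x → x ≤B e → x ≡ e
  ≤B-e x ε = refl
  ≤B-e x ((i , j , i1 , ij , jl , v , refl) ◅ rest) with ≤B-e _ rest
  ... | eq = ⊥-elim (<-asym ij (subst₂ _<_ hi hj v))
    where
    lx : length x ≡ n
    lx = trans (sym (length-swapPos i j x)) (trans (length-≤B rest) length-e)
    ri = proj₁ (BStep-InRange {x} i1 ij jl)
    rj = proj₂ (BStep-InRange {x} i1 ij jl)
    hi : at x i ≡ j
    hi = trans (cong (at x) (sym (τ-right i j (λ q → <-irrefl q ij))))
           (trans (sym (at-swapPos i j x ri rj j))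
               (trans (cong (λ z → at z j) eq) (at-e j (≤-trans i1 (<⇒≤ ij)) (subst (j ≤_) lx jl))))
    hj : at x j ≡ i
    hj = trans (cong (at x) (sym (τ-left i j)))
           (trans (sym (at-swapPos i j x ri rj i))
               (trans (cong (λ z → at z i) eq) (at-e i i1 (subst (i ≤_) lx (≤-trans (<⇒≤ ij) jl)))))

  DistinctEntries-Reduced : ∀ ρ → Reduced ρ → DistinctEntries (perm ρ)
  DistinctEntries-Reduced ρ red = DistinctEntries-perm ρ (Reduced⇒AllGen ρ red)

  subword⇒≤B : ∀ σ ρ → σ ⊑ ρ → Reduced ρ → perm σ ≤B perm ρ
  subword⇒≤B .[] .[] [] _ = ε
  subword⇒≤B σ (a ∷ ρ) (.a ∷ʳ s) (g , asc , red) =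
    subword⇒≤B σ ρ s red ◅◅ (ascent⇒BStep a (perm ρ) (Gen⇒AdjInRange a ρ g) asc ◅ ε)
  subword⇒≤B (a ∷ σ) (.a ∷ ρ) (refl ∷ s) (g , asc , red) =
    [ (λ ascσ → lifting-ascents a σ≤ρ (DistinctEntries-Reduced ρ red) rρ ascσ asc)
    , (λ descσ → descent⇒BStep a (perm σ) rσ descσ ◅ (σ≤ρ ◅◅ (ascent⇒BStep a (perm ρ) rρ asc ◅ ε)))
    ]′ (ascent⊎descent a (perm σ) (DistinctEntries-≤B⁻ σ≤ρ (DistinctEntries-Reduced ρ red)) rσ)
    where
    σ≤ρ = subword⇒≤B σ ρ s red
    rρ = Gen⇒AdjInRange a ρ g
    rσ = AdjInRange-≤B⁻ rρ σ≤ρ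

  ≤B⇒subword : ∀ ρ x → Reduced ρ → x ≤B perm ρ → Σ (List ℕ) λ σ → σ ⊑ ρ × Reduced σ × perm σ ≡ x
  ≤B⇒subword [] x _ x≤e = [] , [] , tt , sym (≤B-e x x≤e)
  ≤B⇒subword (a ∷ ρ) x (g , asc , red) x≤ =
    [ below-ascent , below-descent ]′ (ascent⊎descent a x (DistinctEntries-≤B⁻ x≤ d) rx)
    where
    rρ = Gen⇒AdjInRange a ρ g
    r = Gen⇒AdjInRange a (a ∷ ρ) g
    d = DistinctEntries-Reduced (a ∷ ρ) (g , asc , red)
    rx = AdjInRange-≤B⁻ r x≤
    desc = ascent⇒descent-swapAdj a (perm ρ) rρ asc
    back : ∀ {y} → y ≤B swapAdj a (perm (a ∷ ρ)) → y ≤B perm ρ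
    back {y} = subst (y ≤B_) (swapAdj-involutive a (perm ρ) rρ)
    below-ascent : Ascent a x → Σ (List ℕ) λ σ → σ ⊑ a ∷ ρ × Reduced σ × perm σ ≡ x
    below-ascent ax with ≤B⇒subword ρ x red (back (proj₂ (lifting a x≤ d r ax desc)))
    ... | σ , s , redσ , eq = σ , a ∷ʳ s , redσ , eq
    below-descent : Descent a x → Σ (List ℕ) λ σ → σ ⊑ a ∷ ρ × Reduced σ × perm σ ≡ x
    below-descent dx with ≤B⇒subword ρ (swapAdj a x) red (back (lifting-descents a x≤ d r dx desc))
    ... | σ , s , redσ , eq = a ∷ σ , refl ∷ s , (g , subst (Ascent a) (sym eq) (descent⇒ascent-swapAdj a x rx dx) , redσ) ,
      trans (cong (swapAdj a) eq) (swapAdj-involutive a x rx)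

  inv-e : inv e ≡ 0
  inv-e = inv-applyUpTo-increasing suc n (λ a b lt → s≤s lt)

  inv-perm-Reduced : ∀ ρ → Reduced ρ → inv (perm ρ) ≡ length ρ
  inv-perm-Reduced [] _ = inv-e
  inv-perm-Reduced (a ∷ ρ) (l , ay , red) = trans (inv-swapAdj-ascent a (perm ρ) (Gen⇒AdjInRange a ρ l) ay)
      (cong suc (inv-perm-Reduced ρ red))

  inv-perm-≤ : ∀ ρ → All Gen ρ → inv (perm ρ) ≤ length ρ
  inv-perm-≤ [] _ = ≤-reflexive inv-e
  inv-perm-≤ (a ∷ ρ) (l ∷ al) = ≤-trans (inv-swapAdj-≤ a (perm ρ) (Gen⇒AdjInRange a ρ l)) (s≤s (inv-perm-≤ ρ al))

  inv≡length⇒Reduced : ∀ ρ → All Gen ρ → inv (perm ρ) ≡ length ρ → Reduced ρ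
  inv≡length⇒Reduced [] _ _ = tt
  inv≡length⇒Reduced (a ∷ ρ) (l ∷ al) eq with at (perm ρ) a <? at (perm ρ) (suc a)
  ... | yes h = l , h , inv≡length⇒Reduced ρ al (suc-injective
        (trans (sym (inv-swapAdj-ascent a (perm ρ) (Gen⇒AdjInRange a ρ l) h)) eq))
  ... | no h = ⊥-elim (1+n≰n (subst (_≤ length ρ) eq
        (≤-trans (inv-swapAdj-¬ascent a (perm ρ) (Gen⇒AdjInRange a ρ l) h) (inv-perm-≤ ρ al))))

  swapAdj-act-AllFar : ∀ a ρ z → length z ≡ n → Gen a → All Gen ρ → All (Far a) ρ →
      swapAdj a (act ρ z) ≡ act ρ (swapAdj a z)
  swapAdj-act-AllFar a [] z lz l _ _ = refl
  swapAdj-act-AllFar a (b ∷ ρ) z lz l (lb ∷ al) ((f1 , f2 , f3) ∷ fl) =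
    trans (swapAdj-commute a b (act ρ z) (ra (act ρ z) (trans (length-act ρ z) lz))
        (rb (act ρ z) (trans (length-act ρ z) lz)) f1 f2 f3)
          (cong (swapAdj b) (swapAdj-act-AllFar a ρ z lz l al fl))
    where
    ra : ∀ y → length y ≡ n → AdjInRange a y
    ra y ly = proj₁ l , subst (suc a ≤_) (sym ly) (proj₂ l)
    rb : ∀ y → length y ≡ n → AdjInRange b y
    rb y ly = proj₁ lb , subst (suc b ≤_) (sym ly) (proj₂ lb)

  -- Braids

  braidPerm : ℕ → List ℕ
  braidPerm k = prod n (k ∷ suc k ∷ k ∷ [])

  BraidPattern : List ℕ → Set
  BraidPattern σ = Σ ℕ λ a → Gen a × ((Gen (suc a) × (a ∷ suc a ∷ a ∷ []) ⊑ σ) ⊎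
      (Σ ℕ λ a' → a ≡ suc a' × Gen a' × (a ∷ a' ∷ a ∷ []) ⊑ σ))

  repetitionless⊎braidPattern : ∀ σ → Reduced σ → Repetitionless σ ⊎ BraidPattern σ
  repetitionless⊎braidPattern [] _ = inj₁ tt
  repetitionless⊎braidPattern (a ∷ ω) (l , ay , red) with repetitionless⊎braidPattern ω red
  ... | inj₂ (b , lb , inj₁ (lb' , s)) = inj₂ (b , lb , inj₁ (lb' , a ∷ʳ s))
  ... | inj₂ (b , lb , inj₂ (b' , eq , lb' , s)) = inj₂ (b , lb , inj₂ (b' , eq , lb' , a ∷ʳ s))
  ... | inj₁ rep with a ∈? ω
  ...   | no a∉ = inj₁ (a∉ , rep)
  ...   | yes a∈ with ∈-∃++ a∈
  ...     | ω₁ , ω₂ , refl with suc a ∈? ω₁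
  ...       | yes m = inj₂ (a , l , inj₁ (All-lookup (proj₁ (++⁻ ω₁ (Reduced⇒AllGen _ red))) m ,
                             refl ∷ ∈⇒∷⊑-++ ω₁ m (refl ∷ []⊆-universal ω₂)))
  ...       | no 1+a∉ω₁ = via-predecessor a l refl
    where
    gens = Reduced⇒AllGen (ω₁ ++ a ∷ ω₂) red
    gens₁ = proj₁ (++⁻ ω₁ gens)
    gens₂ = All-tail (proj₂ (++⁻ ω₁ gens))
    a∉ω₁ : a ∉ ω₁
    a∉ω₁ = Repetitionless-middle ω₁ a ω₂ rep
    cancel : All (Far a) ω₁ → perm (a ∷ ω₁ ++ a ∷ ω₂) ≡ perm (ω₁ ++ ω₂)
    cancel fl = trans (cong (swapAdj a) (act-++ ω₁ (a ∷ ω₂) e))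
             (trans (swapAdj-act-AllFar a ω₁ (perm (a ∷ ω₂)) (length-perm (a ∷ ω₂)) l gens₁ fl)
             (trans (cong (act ω₁) (swapAdj-involutive a (perm ω₂) (Gen⇒AdjInRange a ω₂ l))) (sym (act-++ ω₁ ω₂ e))))
    far⇒¬reduced : All (Far a) ω₁ → ⊥
    far⇒¬reduced fl = 1+n≰n (≤-trans inv≥ (≤-trans (inv-perm-≤ (ω₁ ++ ω₂) (++⁺ gens₁ gens₂)) (≤-reflexive (length-++ ω₁))))
      where
      inv≡ : inv (perm (ω₁ ++ ω₂)) ≡ suc (length ω₁ + suc (length ω₂))
      inv≡ = trans (cong inv (sym (cancel fl))) (trans (inv-perm-Reduced (a ∷ ω₁ ++ a ∷ ω₂) (l , ay , red))
          (cong suc (length-++ ω₁)))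
      inv≥ : suc (length ω₁ + length ω₂) ≤ inv (perm (ω₁ ++ ω₂))
      inv≥ = subst (suc (length ω₁ + length ω₂) ≤_) (sym inv≡) (s≤s (≤-trans (+-monoʳ-≤ (length ω₁) (n≤1+n _)) ≤-refl))
    all-far : ∀ ρ → a ∉ ρ → suc a ∉ ρ → (∀ b → suc b ≡ a → b ∉ ρ) → All (Far a) ρ
    all-far [] _ _ _ = []
    all-far (b ∷ ρ) h1 h2 h3 = ((λ q → h1 (here (sym q))) , (λ q → h3 b q (here refl)) , (λ q → h2 (here (sym q)))) ∷
      all-far ρ (λ m → h1 (there m)) (λ m → h2 (there m)) (λ c q m → h3 c q (there m))
    via-predecessor : ∀ c → Gen c → c ≡ a → Repetitionless (a ∷ ω₁ ++ a ∷ ω₂) ⊎ BraidPattern (a ∷ ω₁ ++ a ∷ ω₂)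
    via-predecessor zero (() , _) _
    via-predecessor (suc c) lc refl with c ∈? ω₁
    ... | yes m = inj₂ (suc c , l , inj₂ (c , refl , All-lookup gens₁ m , refl ∷ ∈⇒∷⊑-++ ω₁ m (refl ∷ []⊆-universal ω₂)))
    ... | no m = ⊥-elim (far⇒¬reduced (all-far ω₁ a∉ω₁ 1+a∉ω₁ (λ b q mb → m (subst (_∈ ω₁) (suc-injective q) mb))))

  Window : ℕ → List ℕ → ℕ → ℕ → ℕ → Set
  Window k x α β γ = length x ≡ n × (∀ t → 1 ≤ t → t ≤ n → Outside k t → at x t ≡ t) ×
    at x k ≡ α × at x (suc k) ≡ β × at x (suc (suc k)) ≡ γ

  BraidIndex : ℕ → Set
  BraidIndex k = 1 ≤ k × suc (suc k) ≤ n

  Window-e : ∀ k → BraidIndex k → Window k e k (suc k) (suc (suc k))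
  Window-e k (k1 , kn) = length-e , (λ t t1 tn _ → at-e t t1 tn) ,
    at-e k k1 (≤-trans (n≤1+n k) (≤-trans (n≤1+n _) kn)) , at-e (suc k) (s≤s z≤n) (≤-trans (n≤1+n _) kn) ,
        at-e (suc (suc k)) (s≤s z≤n) kn

  Window-swapAdj₀ : ∀ k x α β γ → BraidIndex k → Window k x α β γ → Window k (swapAdj k x) β α γ
  Window-swapAdj₀ k x α β γ (k1 , kn) (lx , o , ha , hb , hc) =
    trans (length-swapAdj k x) lx ,
    (λ t t1 tn (o1 , o2 , o3) → trans (at-swapPos k (suc k) x ra rb t)
        (trans (cong (at x) (τ-fixed k (suc k) t o1 o2)) (o t t1 tn (o1 , o2 , o3)))) ,
    trans (at-swapPos k (suc k) x ra rb k) (trans (cong (at x) (τ-left k (suc k))) hb) ,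
    trans (at-swapPos k (suc k) x ra rb (suc k)) (trans (cong (at x) (τ-right k (suc k) (n≢1+n k))) ha) ,
    trans (at-swapPos k (suc k) x ra rb (suc (suc k)))
        (trans (cong (at x) (τ-fixed k (suc k) (suc (suc k)) (2+n≢n k) 1+n≢n)) hc)
    where
    ra : InRange k x
    ra = k1 , subst (k ≤_) (sym lx) (≤-trans (n≤1+n k) (≤-trans (n≤1+n _) kn))
    rb : InRange (suc k) x
    rb = s≤s z≤n , subst (suc k ≤_) (sym lx) (≤-trans (n≤1+n _) kn)

  BraidIndex-suc≤n : ∀ k → BraidIndex k → suc k ≤ n
  BraidIndex-suc≤n k (_ , kn) = ≤-trans (n≤1+n _) kn

  Window-swapAdj₁ : ∀ k x α β γ → BraidIndex k → Window k x α β γ → Window k (swapAdj (suc k) x) α γ β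
  Window-swapAdj₁ k x α β γ (k1 , kn) (lx , o , ha , hb , hc) =
    trans (length-swapAdj (suc k) x) lx ,
    (λ t t1 tn (o1 , o2 , o3) → trans (at-swapPos (suc k) (suc (suc k)) x ra rb t)
        (trans (cong (at x) (τ-fixed (suc k) (suc (suc k)) t o2 o3)) (o t t1 tn (o1 , o2 , o3)))) ,
    trans (at-swapPos (suc k) (suc (suc k)) x ra rb k)
        (trans (cong (at x) (τ-fixed (suc k) (suc (suc k)) k (n≢1+n k) (λ q → 2+n≢n k (sym q)))) ha) ,
    trans (at-swapPos (suc k) (suc (suc k)) x ra rb (suc k)) (trans (cong (at x) (τ-left (suc k) (suc (suc k)))) hc) ,
    trans (at-swapPos (suc k) (suc (suc k)) x ra rb (suc (suc k)))
        (trans (cong (at x) (τ-right (suc k) (suc (suc k)) (n≢1+n (suc k)))) hb)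
    where
    ra : InRange (suc k) x
    ra = s≤s z≤n , subst (suc k ≤_) (sym lx) (≤-trans (n≤1+n _) kn)
    rb : InRange (suc (suc k)) x
    rb = s≤s z≤n , subst (suc (suc k) ≤_) (sym lx) kn

  Window-unique : ∀ k x y α β γ → Window k x α β γ → Window k y α β γ → x ≡ y
  Window-unique k x y α β γ (lx , ox , ax , bx , cx) (ly , oy , ay , by , cy) = at-ext x y (trans lx (sym ly)) h
    where
    h : ∀ p → at x p ≡ at y p
    h zero = trans (at-zero x) (sym (at-zero y))
    h (suc r) with suc r ≤? n
    ... | no gt = trans (at-beyond x r (subst (_≤ r) (sym lx) (≤-pred (≰⇒> gt))))
          (sym (at-beyond y r (subst (_≤ r) (sym ly) (≤-pred (≰⇒> gt)))))
    ... | yes le with suc r ≟ k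
    ...   | yes q rewrite q = trans ax (sym ay)
    ...   | no q1 with suc r ≟ suc k
    ...     | yes q rewrite q = trans bx (sym by)
    ...     | no q2 with suc r ≟ suc (suc k)
    ...       | yes q rewrite q = trans cx (sym cy)
    ...       | no q3 = trans (ox (suc r) (s≤s z≤n) le (q1 , q2 , q3)) (sym (oy (suc r) (s≤s z≤n) le (q1 , q2 , q3)))

  module Braid (k : ℕ) (kr : BraidIndex k) where

    window-k : Window k (perm (k ∷ [])) (suc k) k (suc (suc k))
    window-k = Window-swapAdj₀ k e k (suc k) (suc (suc k)) kr (Window-e k kr)

    window-k' : Window k (perm (suc k ∷ [])) k (suc (suc k)) (suc k)
    window-k' = Window-swapAdj₁ k e k (suc k) (suc (suc k)) kr (Window-e k kr)

    window-k'k : Window k (perm (suc k ∷ k ∷ [])) (suc k) (suc (suc k)) k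
    window-k'k = Window-swapAdj₁ k (perm (k ∷ [])) (suc k) k (suc (suc k)) kr window-k

    window-kk' : Window k (perm (k ∷ suc k ∷ [])) (suc (suc k)) k (suc k)
    window-kk' = Window-swapAdj₀ k (perm (suc k ∷ [])) k (suc (suc k)) (suc k) kr window-k'

    window-kk'k : Window k (perm (k ∷ suc k ∷ k ∷ [])) (suc (suc k)) (suc k) k
    window-kk'k = Window-swapAdj₀ k (perm (suc k ∷ k ∷ [])) (suc k) (suc (suc k)) k kr window-k'k

    window-k'kk' : Window k (perm (suc k ∷ k ∷ suc k ∷ [])) (suc (suc k)) (suc k) k
    window-k'kk' = Window-swapAdj₁ k (perm (k ∷ suc k ∷ [])) (suc (suc k)) k (suc k) kr window-kk'

    braid-relation : perm (k ∷ suc k ∷ k ∷ []) ≡ perm (suc k ∷ k ∷ suc k ∷ [])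
    braid-relation = Window-unique k _ _ (suc (suc k)) (suc k) k window-kk'k window-k'kk'

    gen-k : Gen k
    gen-k = proj₁ kr , BraidIndex-suc≤n k kr

    gen-k' : Gen (suc k)
    gen-k' = s≤s z≤n , proj₂ kr

    Window-ascent₀ : ∀ x α β γ → Window k x α β γ → α < β → Ascent k x
    Window-ascent₀ x α β γ (_ , _ , ha , hb , _) lt = subst₂ _<_ (sym ha) (sym hb) lt

    Window-ascent₁ : ∀ x α β γ → Window k x α β γ → β < γ → Ascent (suc k) x
    Window-ascent₁ x α β γ (_ , _ , _ , hb , hc) lt = subst₂ _<_ (sym hb) (sym hc) lt

    k<sk : k < suc k
    k<sk = n<1+n k

    sk<ssk : suc k < suc (suc k)
    sk<ssk = n<1+n (suc k)

    k<ssk : k < suc (suc k)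
    k<ssk = <-trans k<sk sk<ssk

    reduced-kk'k : Reduced (k ∷ suc k ∷ k ∷ [])
    reduced-kk'k = gen-k , Window-ascent₀ (perm (suc k ∷ k ∷ [])) _ _ _ window-k'k sk<ssk , gen-k' ,
        Window-ascent₁ (perm (k ∷ [])) _ _ _ window-k k<ssk , gen-k , Window-ascent₀ e _ _ _ (Window-e k kr) k<sk , tt

    reduced-k'kk' : Reduced (suc k ∷ k ∷ suc k ∷ [])
    reduced-k'kk' = gen-k' , Window-ascent₁ (perm (k ∷ suc k ∷ [])) _ _ _ window-kk' k<sk , gen-k ,
        Window-ascent₀ (perm (suc k ∷ [])) _ _ _ window-k' k<ssk , gen-k' ,
        Window-ascent₁ e _ _ _ (Window-e k kr) sk<ssk , tt

    reduced-k'k : Reduced (suc k ∷ k ∷ [])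
    reduced-k'k = proj₂ (proj₂ reduced-kk'k)

    reduced-kk' : Reduced (k ∷ suc k ∷ [])
    reduced-kk' = proj₂ (proj₂ reduced-k'kk')

    subword⇒≤B-kk'k : ∀ {σ} → σ ⊑ (k ∷ suc k ∷ k ∷ []) → perm σ ≤B perm (k ∷ suc k ∷ k ∷ [])
    subword⇒≤B-kk'k s = subword⇒≤B _ _ s reduced-kk'k

  Window-descent : ∀ k x α β γ a → BraidIndex k → Window k x α β γ → k ≤ α → γ ≤ suc (suc k) → Gen a → Descent a x →
    (a ≡ k × β < α) ⊎ (a ≡ suc k × γ < β)
  Window-descent k x α β γ a kr (lx , o , ha , hb , hc) kα γk (a1 , an) d with a ≟ k
  ... | yes q rewrite q = inj₁ (refl , subst₂ _<_ hb ha d)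
  ... | no q1 with a ≟ suc k
  ...   | yes q rewrite q = inj₂ (refl , subst₂ _<_ hc hb d)
  ...   | no q2 with suc a ≟ k
  ...     | yes q = ⊥-elim (<-asym d' (≤-trans (n<1+n a) (subst (_≤ α) (sym q) kα)))
    where
    d' : α < a
    d' = subst₂ _<_ (trans (cong (at x) q) ha) (o a a1 (≤-trans (n≤1+n a) an)
        (Outside-below k a (subst (a <_) q (n<1+n a)))) d
  ...     | no q3 with a ≟ suc (suc k)
  ...       | yes q = ⊥-elim (<-asym d' (s≤s (subst (γ ≤_) (sym q) γk)))
    where
    o' : Outside k (suc a)
    o' = q3 , (λ r → q1 (suc-injective r)) , (λ r → q2 (suc-injective r))
    d' : suc a < γ
    d' = subst₂ _<_ (o (suc a) (s≤s z≤n) an o') (trans (cong (at x) q) hc) d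
  ...       | no q4 = ⊥-elim (<-asym d' (n<1+n a))
    where
    o' : Outside k (suc a)
    o' = q3 , (λ r → q1 (suc-injective r)) , (λ r → q2 (suc-injective r))
    d' : suc a < a
    d' = subst₂ _<_ (o (suc a) (s≤s z≤n) an o') (o a a1 (≤-trans (n≤1+n a) an) (q1 , q2 , q4)) d

  Window-peel : ∀ k a ω α β γ → BraidIndex k → Reduced (a ∷ ω) → Window k (perm (a ∷ ω)) α β γ → k ≤ α →
      γ ≤ suc (suc k) →
    (a ≡ k × β < α × Window k (perm ω) β α γ) ⊎ (a ≡ suc k × γ < β × Window k (perm ω) α γ β)
  Window-peel k a ω α β γ kr (l , ay , red) b kα γk with Window-descent k (perm (a ∷ ω)) α β γ a kr b kα γk l
      (ascent⇒descent-swapAdj a (perm ω) (Gen⇒AdjInRange a ω l) ay)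
  ... | inj₁ (refl , lt) = inj₁ (refl , lt , subst (λ z → Window a z β α γ)
        (swapAdj-involutive a (perm ω) (Gen⇒AdjInRange a ω l)) (Window-swapAdj₀ a (perm (a ∷ ω)) α β γ kr b))
  ... | inj₂ (refl , lt) = inj₂ (refl , lt , subst (λ z → Window k z α γ β)
        (swapAdj-involutive (suc k) (perm ω) (Gen⇒AdjInRange (suc k) ω l))
        (Window-swapAdj₁ k (perm (suc k ∷ ω)) α β γ kr b))

  Window-[] : ∀ k α β γ → BraidIndex k → Window k (perm []) α β γ → α ≡ k × β ≡ suc k
  Window-[] k α β γ kr (_ , _ , ha , hb , _) with Window-e k kr
  ... | (_ , _ , ea , eb , _) = trans (sym ha) ea , trans (sym hb) eb

  Window-e-¬Reduced : ∀ k f ρ → BraidIndex k → Reduced (f ∷ ρ) → Window k (perm (f ∷ ρ)) k (suc k) (suc (suc k)) → ⊥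
  Window-e-¬Reduced k f ρ kr red b with Window-peel k f ρ k (suc k) (suc (suc k)) kr red b ≤-refl ≤-refl
  ... | inj₁ (_ , lt , _) = <-asym lt (n<1+n k)
  ... | inj₂ (_ , lt , _) = <-asym lt (n<1+n (suc k))

  -- Each letter peeled off a reduced word undoes a descent inside the window, and from the window
  -- (k+2, k+1, k) down to the identity this leaves exactly two possible orders.
  braidPerm-reducedWords : ∀ k → BraidIndex k → ∀ σ → Reduced σ → perm σ ≡ perm (k ∷ suc k ∷ k ∷ []) →
    σ ≡ (k ∷ suc k ∷ k ∷ []) ⊎ σ ≡ (suc k ∷ k ∷ suc k ∷ [])
  braidPerm-reducedWords k kr σ red eq = go σ red (subst (λ z → Window k z (suc (suc k)) (suc k) k) (sym eq)
      (Braid.window-kk'k k kr))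
    where
    k≤sk = n≤1+n k
    k≤ssk = ≤-trans (n≤1+n k) (n≤1+n _)
    go : ∀ σ → Reduced σ → Window k (perm σ) (suc (suc k)) (suc k) k →
        σ ≡ (k ∷ suc k ∷ k ∷ []) ⊎ σ ≡ (suc k ∷ k ∷ suc k ∷ [])
    go [] _ b = ⊥-elim (2+n≢n k (proj₁ (Window-[] k _ _ _ kr b)))
    go (a ∷ ω) red b with Window-peel k a ω (suc (suc k)) (suc k) k kr red b k≤ssk k≤ssk
    go (a ∷ []) red b | inj₁ (refl , _ , b₁) = ⊥-elim (1+n≢n (proj₁ (Window-[] k _ _ _ kr b₁)))
    go (a ∷ c ∷ ω') (_ , _ , red) b | inj₁ (refl , _ , b₁) with Window-peel k c ω' (suc k) (suc (suc k)) k kr red b₁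
        k≤sk k≤ssk
    ... | inj₁ (_ , lt , _) = ⊥-elim (<-asym lt sk<ssk)
      where open Braid k kr
    go (a ∷ c ∷ []) (_ , _ , red) b | inj₁ (refl , _ , b₁) | inj₂ (refl , _ , b₂) =
        ⊥-elim (1+n≢n (proj₁ (Window-[] k _ _ _ kr b₂)))
    go (a ∷ c ∷ d ∷ ω'') (_ , _ , _ , _ , red) b | inj₁ (refl , _ , b₁)
        | inj₂ (refl , _ , b₂) with Window-peel k d ω'' (suc k) k (suc (suc k)) kr red b₂ k≤sk ≤-refl
    ... | inj₂ (_ , lt , _) = ⊥-elim (<-asym lt (≤-trans (n<1+n k) (n≤1+n _)))
    go (a ∷ c ∷ d ∷ []) (_ , _ , red) b | inj₁ (refl , _ , b₁) | inj₂ (refl , _ , b₂) | inj₁ (refl , _ , b₃) =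
        inj₁ refl
    go (a ∷ c ∷ d ∷ f ∷ ρ) (_ , _ , _ , _ , red) b | inj₁ (refl , _ , b₁) | inj₂ (refl , _ , b₂)
        | inj₁ (refl , _ , b₃) = ⊥-elim (Window-e-¬Reduced k f ρ kr (proj₂ (proj₂ red)) b₃)
    go (a ∷ []) red b | inj₂ (refl , _ , b₁) = ⊥-elim (2+n≢n k (proj₁ (Window-[] k _ _ _ kr b₁)))
    go (a ∷ c ∷ ω') (_ , _ , red) b | inj₂ (refl , _ , b₁) with Window-peel k c ω' (suc (suc k)) k (suc k) kr red b₁
        k≤ssk (n≤1+n _)
    ... | inj₂ (_ , lt , _) = ⊥-elim (<-asym lt (n<1+n k))
    go (a ∷ c ∷ []) (_ , _ , red) b | inj₂ (refl , _ , b₁) | inj₁ (refl , _ , b₂) =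
        ⊥-elim (1+n≢n (proj₂ (Window-[] k _ _ _ kr b₂)))
    go (a ∷ c ∷ d ∷ ω'') (_ , _ , _ , _ , red) b | inj₂ (refl , _ , b₁)
        | inj₁ (refl , _ , b₂) with Window-peel k d ω'' k (suc (suc k)) (suc k) kr red b₂ ≤-refl (n≤1+n _)
    ... | inj₁ (_ , lt , _) = ⊥-elim (<-asym lt (≤-trans (n<1+n k) (n≤1+n _)))
    go (a ∷ c ∷ d ∷ []) (_ , _ , red) b | inj₂ (refl , _ , b₁) | inj₁ (refl , _ , b₂) | inj₂ (refl , _ , b₃) =
        inj₂ refl
    go (a ∷ c ∷ d ∷ f ∷ ρ) (_ , _ , _ , _ , red) b | inj₂ (refl , _ , b₁) | inj₁ (refl , _ , b₂)
        | inj₂ (refl , _ , b₃) = ⊥-elim (Window-e-¬Reduced k f ρ kr (proj₂ (proj₂ red)) b₃)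

  rank-Window-below : ∀ k x α β γ → BraidIndex k → Window k x α β γ → ∀ p → p < k → ∀ q → p ≤ q → rank x p q ≡ 0
  rank-Window-below k x α β γ kr b zero _ q _ = refl
  rank-Window-below k x α β γ kr b@(lx , o , _) (suc p) lt q le
    rewrite rank-Window-below k x α β γ kr b p (<-trans (n<1+n p) lt) q (≤-trans (n≤1+n p) le)
          | o (suc p) (s≤s z≤n) (≤-trans (<⇒≤ lt) (≤-trans (n≤1+n k) (≤-trans (n≤1+n _) (proj₂ kr))))
              (Outside-below k (suc p) lt)
          | ≮⇒<ᵇ-false q (suc p) (λ h → <-irrefl refl (<-≤-trans h le)) = refl

  rank-Window-k : ∀ k x α β γ → BraidIndex k → Window k x α β γ → ∀ q → k ≤ suc q → rank x k q ≡ indicator (q <ᵇ α)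
  rank-Window-k (suc k0) x α β γ kr b@(_ , _ , ha , _) q le rewrite rank-Window-below (suc k0) x α β γ kr b k0
      (n<1+n k0) q (≤-pred le) | ha = refl

  rank-Window-k' : ∀ k x α β γ → BraidIndex k → Window k x α β γ → ∀ q → k ≤ suc q →
      rank x (suc k) q ≡ indicator (q <ᵇ α) + indicator (q <ᵇ β)
  rank-Window-k' k x α β γ kr b@(_ , _ , _ , hb , _) q le rewrite rank-Window-k k x α β γ kr b q le | hb = refl

  -- Comparing ranks, perm [k] ≤ j ≤ perm [k, k+1] forces j(k+1) ≤ k, while
  -- perm [k+1] ≤ j ≤ perm [k+1, k] forces j(k+1) > k+1.
  atoms-have-no-join : ∀ k → BraidIndex k → ∀ j → perm (k ∷ []) ≤B j → perm (suc k ∷ []) ≤B j →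
    j ≤B perm (suc k ∷ k ∷ []) → j ≤B perm (k ∷ suc k ∷ []) → ⊥
  atoms-have-no-join k kr j sₖ≤j sₖ₊₁≤j j≤t₁ j≤t₂ = contradiction
    where
    open Braid k kr
    k≤1+k = n≤1+n k
    r₁ : 1 ≤ rank j k k
    r₁ = ≤-trans (≤-reflexive (trans (sym (cong indicator (<⇒<ᵇ-true k (suc k) (n<1+n k))))
        (sym (rank-Window-k k _ _ _ _ kr window-k k k≤1+k)))) (rank-≤B sₖ≤j k k)
    r₂ : rank j (suc k) k ≤ 1
    r₂ = ≤-trans (rank-≤B j≤t₂ (suc k) k) (≤-reflexive
        (trans (rank-Window-k' k _ _ _ _ kr window-kk' k k≤1+k)
        (cong₂ _+_ (cong indicator (<⇒<ᵇ-true k (suc (suc k)) k<ssk))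
        (cong indicator (≮⇒<ᵇ-false k k (<-irrefl refl))))))
    r₃ : rank j k (suc k) ≡ 0
    r₃ = n≤0⇒n≡0 (≤-trans (rank-≤B j≤t₁ k (suc k))
        (≤-reflexive (trans (rank-Window-k k _ _ _ _ kr window-k'k (suc k) (≤-trans k≤1+k (n≤1+n _)))
        (cong indicator (≮⇒<ᵇ-false (suc k) (suc k) (<-irrefl refl))))))
    r₄ : 1 ≤ rank j (suc k) (suc k)
    r₄ = ≤-trans (≤-reflexive (sym (trans (rank-Window-k' k _ _ _ _ kr window-k' (suc k) (≤-trans k≤1+k (n≤1+n _)))
        (cong₂ _+_ (cong indicator (≮⇒<ᵇ-false (suc k) k (<-asym (n<1+n k))))
        (cong indicator (<⇒<ᵇ-true (suc k) (suc (suc k)) sk<ssk)))))) (rank-≤B sₖ₊₁≤j (suc k) (suc k))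
    contradiction : ⊥
    contradiction with suc k <? at j (suc k)
    ... | yes big = <-irrefl refl (≤-trans (+-mono-≤ r₁
          (≤-reflexive (sym (cong indicator (<⇒<ᵇ-true k _ (<-trans (n<1+n k) big)))))) r₂)
    ... | no ¬big = <-irrefl refl (≤-trans r₄ (≤-reflexive
          (trans (cong (_+ indicator (suc k <ᵇ at j (suc k))) r₃) (cong indicator (≮⇒<ᵇ-false (suc k) _ ¬big)))))

  braidPerm-¬boolean : ∀ k → BraidIndex k → ¬ IsBoolean (perm (k ∷ suc k ∷ k ∷ []))
  braidPerm-¬boolean k kr bool
    with IsBoolean⇒join bool (Braid.subword⇒≤B-kk'k k kr (k ∷ʳ suc k ∷ʳ refl ∷ []))
        (Braid.subword⇒≤B-kk'k k kr (k ∷ʳ refl ∷ k ∷ʳ []))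
  ... | j , sₖ≤j , sₖ₊₁≤j , least = atoms-have-no-join k kr j sₖ≤j sₖ₊₁≤j
    (least _ (subword⇒≤B-kk'k (k ∷ʳ refl ∷ refl ∷ [])) (subword⇒≤B _ _ (suc k ∷ʳ refl ∷ []) reduced-k'k)
        (subword⇒≤B _ _ (refl ∷ k ∷ʳ []) reduced-k'k))
    (least _ (subword⇒≤B-kk'k (refl ∷ refl ∷ k ∷ʳ [])) (subword⇒≤B _ _ (refl ∷ suc k ∷ʳ []) reduced-kk')
        (subword⇒≤B _ _ (k ∷ʳ refl ∷ []) reduced-kk'))
    where open Braid k kr

  -- Boolean ideals

  Separated : ℕ → List ℕ → Set
  Separated a x = length x ≡ n × (∀ t → 1 ≤ t → t ≤ a → at x t ≤ a) × (∀ t → a < t → t ≤ n → a < at x t)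

  Separated-swapPos : ∀ a i j x y → SameSide a i j → InRange i y → InRange j y → x ≡ swapPos i j y → Separated a y →
      Separated a x
  Separated-swapPos a i j x y s ri rj refl (ly , h1 , h2) = trans (length-swapPos i j y) ly ,
    (λ t t1 ta → subst (_≤ a) (sym (at-swapPos i j y ri rj t)) (h1 (τ i j t) (tnz t t1) (τ-SameSide-≤ a i j t s ta))) ,
    (λ t at tn → subst (a <_) (sym (at-swapPos i j y ri rj t))
        (h2 (τ i j t) (τ-SameSide-> a i j t s at) (tle t (≤-trans (s≤s z≤n) at) tn)))
    where
    tnz : ∀ t → 1 ≤ t → 1 ≤ τ i j t
    tnz t t1 with t ≡ᵇ i | t ≡ᵇ j
    ... | true | _ = proj₁ rj
    ... | false | true = proj₁ ri
    ... | false | false = t1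
    tle : ∀ t → 1 ≤ t → t ≤ n → τ i j t ≤ n
    tle t _ tn with t ≡ᵇ i | t ≡ᵇ j
    ... | true | _ = subst (j ≤_) ly (proj₂ rj)
    ... | false | true = subst (i ≤_) ly (proj₂ ri)
    ... | false | false = tn

  Separated-e : ∀ a → Gen a → Separated a e
  Separated-e a l = length-e , (λ t t1 ta → subst (_≤ a) (sym (at-e t t1 (≤-trans ta (≤-trans (n≤1+n a) (proj₂ l)))))
      ta) ,
    (λ t at tn → subst (a <_) (sym (at-e t (≤-trans (s≤s z≤n) at) tn)) at)

  Separated-swapAdj : ∀ a b x → Gen b → b ≢ a → Separated a x → Separated a (swapAdj b x)
  Separated-swapAdj a b x (b1 , bn) ba sx@(lx , _) = Separated-swapPos a b (suc b) (swapAdj b x) x side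
    (b1 , subst (b ≤_) (sym lx) (≤-trans (n≤1+n b) bn)) (s≤s z≤n , subst (suc b ≤_) (sym lx) bn) refl sx
    where
    side : SameSide a b (suc b)
    side with <-cmp b a
    ... | tri< lt _ _ = inj₁ (<⇒≤ lt , lt)
    ... | tri≈ _ eq _ = ⊥-elim (ba eq)
    ... | tri> _ _ gt = inj₂ (gt , <-trans gt (n<1+n b))

  Separated-perm : ∀ a ω → Gen a → All Gen ω → a ∉ ω → Separated a (perm ω)
  Separated-perm a [] l _ _ = Separated-e a l
  Separated-perm a (b ∷ ω) l (lb ∷ al) ni = Separated-swapAdj a b (perm ω) lb (λ q → ni (here (sym q)))
      (Separated-perm a ω l al (λ m → ni (there m)))

  Separated-BStep⁻ : ∀ a x y → BStep x y → Separated a y → Separated a x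
  Separated-BStep⁻ a x y (i , j , i1 , ij , jl , v , refl) sy@(ly , h1 , h2) =
    Separated-swapPos a i j x y side (InRange-swapPos i i j x ri) (InRange-swapPos j i j x rj)
        (sym (swapPos-involutive i j x ri rj)) sy
    where
    ri = proj₁ (BStep-InRange {x} i1 ij jl)
    rj = proj₂ (BStep-InRange {x} i1 ij jl)
    lx : length x ≡ n
    lx = trans (sym (length-swapPos i j x)) ly
    side : SameSide a i j
    side with i ≤? a | j ≤? a
    ... | yes p | yes q = inj₁ (p , q)
    ... | no p | _ = inj₂ (≰⇒> p , <-trans (≰⇒> p) ij)
    ... | yes p | no q = ⊥-elim (<-irrefl refl (<-≤-trans (<-trans xi v) xj))
      where
      xj : at x j ≤ a
      xj = subst (_≤ a) (trans (at-swapPos i j x ri rj i) (cong (at x) (τ-left i j))) (h1 i i1 p)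
      xi : a < at x i
      xi = subst (a <_) (trans (at-swapPos i j x ri rj j) (cong (at x) (τ-right i j (λ e → <-irrefl e ij))))
          (h2 j (≰⇒> q) (subst (j ≤_) lx jl))

  Separated-≤B⁻ : ∀ a {x y} → x ≤B y → Separated a y → Separated a x
  Separated-≤B⁻ a ε s = s
  Separated-≤B⁻ a (st ◅ r) s = Separated-BStep⁻ a _ _ st (Separated-≤B⁻ a r s)

  Separated⇒ascent : ∀ a x → Gen a → Separated a x → Ascent a x
  Separated⇒ascent a x (a1 , an) (lx , h1 , h2) = ≤-<-trans (h1 a a1 ≤-refl) (h2 (suc a) (n<1+n a) an)

  e-boolean : IsBoolean e
  e-boolean = 0 , (λ _ _ → []) , (λ x y px py → (λ _ mem → mem) ,
      (λ _ → subst₂ _≤B_ (sym (≤B-e x px)) (sym (≤B-e y py)) ε)) ,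
    (λ x y px py _ → trans (≤B-e x px) (sym (≤B-e y py))) , (λ { [] → e , ε , refl })

  -- If a does not occur in ω, then perm ω is Separated at a, hence so is everything below it, and
  -- all these have an ascent at a.  By the lifting property every x ≤ perm (a ∷ ω) is then either
  -- below perm ω or of the form x' σₐ with x' ≤ perm ω, and one more bit records which.
  module BooleanExtension (a : ℕ) (ω : List ℕ) (l : Gen a) (ay : Ascent a (perm ω)) (red : Reduced ω) (a∉ : a ∉ ω)
              (m : ℕ) (f : (x : List ℕ) → x ≤B perm ω → Subset m)
              (ord : ∀ x y (p : x ≤B perm ω) (q : y ≤B perm ω) → (x ≤B y → f x p ⊆ˢ f y q) × (f x p ⊆ˢ f y q → x ≤B y))
              (inj : ∀ x y (p : x ≤B perm ω) (q : y ≤B perm ω) → f x p ≡ f y q → x ≡ y)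
              (surj : ∀ (S : Subset m) → ∃[ x ] Σ (x ≤B perm ω) λ p → f x p ≡ S) where
    u = perm ω
    us = swapAdj a u
    ru : AdjInRange a u
    ru = Gen⇒AdjInRange a ω l
    rus : AdjInRange a us
    rus = Gen⇒AdjInRange a (a ∷ ω) l
    alω = Reduced⇒AllGen ω red
    dus : DistinctEntries us
    dus = DistinctEntries-perm (a ∷ ω) (l ∷ alω)
    du : DistinctEntries u
    du = DistinctEntries-perm ω alω
    descent-us : Descent a us
    descent-us = ascent⇒descent-swapAdj a u ru ay
    sepu : Separated a u
    sepu = Separated-perm a ω l alω a∉
    range-≤us : ∀ x → x ≤B us → AdjInRange a x
    range-≤us x p = AdjInRange-≤B⁻ rus p
    range-≤u : ∀ x → x ≤B u → AdjInRange a x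
    range-≤u x p = AdjInRange-≤B⁻ ru p
    ascent⊎descent-≤us : ∀ x → x ≤B us → Ascent a x ⊎ Descent a x
    ascent⊎descent-≤us x p = ascent⊎descent a x (DistinctEntries-≤B⁻ p dus) (range-≤us x p)
    ascent⇒≤u : ∀ x → x ≤B us → Ascent a x → x ≤B u
    ascent⇒≤u x p ax = subst (x ≤B_) (swapAdj-involutive a u ru) (proj₂ (lifting a p dus rus ax descent-us))
    descent⇒swap≤u : ∀ x → x ≤B us → Descent a x → swapAdj a x ≤B u
    descent⇒swap≤u x p dx = subst (swapAdj a x ≤B_) (swapAdj-involutive a u ru)
        (lifting-descents a p dus rus dx descent-us)
    tag : ∀ x → x ≤B us → Ascent a x ⊎ Descent a x → Subset (suc m)
    tag x p (inj₁ ax) = outside ∷ f x (ascent⇒≤u x p ax)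
    tag x p (inj₂ dx) = inside ∷ f (swapAdj a x) (descent⇒swap≤u x p dx)
    g : (x : List ℕ) → x ≤B us → Subset (suc m)
    g x p = tag x p (ascent⊎descent-≤us x p)
    ≤u⇒ascent : ∀ y → y ≤B u → Ascent a y
    ≤u⇒ascent y q = Separated⇒ascent a y l (Separated-≤B⁻ a q sepu)
    f-irrelevant : ∀ x x' (p : x ≤B u) (p' : x' ≤B u) → x ≡ x' → f x p ≡ f x' p'
    f-irrelevant x .x p p' refl = ⊆-antisym (proj₁ (ord x x p p') ε) (proj₁ (ord x x p' p) ε)

    tag-order : ∀ x y (px : x ≤B us) (py : y ≤B us) sx sy →
        (x ≤B y → tag x px sx ⊆ˢ tag y py sy) × (tag x px sx ⊆ˢ tag y py sy → x ≤B y)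
    tag-order x y px py (inj₁ ax) (inj₁ ay') =
      (λ le → ∷⁺-⊆ outside _ _ (proj₁ (ord x y (ascent⇒≤u x px ax) (ascent⇒≤u y py ay')) le)) ,
      (λ h → proj₂ (ord x y (ascent⇒≤u x px ax) (ascent⇒≤u y py ay')) (∷⁻-⊆ _ _ _ _ h))
    tag-order x y px py (inj₂ dx) (inj₂ dy) =
      (λ le → ∷⁺-⊆ inside _ _ (proj₁ (ord (swapAdj a x) (swapAdj a y) (descent⇒swap≤u x px dx) (descent⇒swap≤u y py dy))
          (lifting-descents a le (DistinctEntries-≤B⁻ py dus) (range-≤us y py) dx dy))) ,
      (λ h → subst₂ _≤B_ (swapAdj-involutive a x (range-≤us x px)) (swapAdj-involutive a y (range-≤us y py))
               (lifting-ascents a (proj₂ (ord (swapAdj a x) (swapAdj a y) (descent⇒swap≤u x px dx)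
                   (descent⇒swap≤u y py dy)) (∷⁻-⊆ _ _ _ _ h))
                 (DistinctEntries-≤B⁻ (descent⇒swap≤u y py dy) du) (range-≤u (swapAdj a y) (descent⇒swap≤u y py dy))
                     (descent⇒ascent-swapAdj a x (range-≤us x px) dx) (descent⇒ascent-swapAdj a y (range-≤us y py) dy)))
    tag-order x y px py (inj₁ ax) (inj₂ dy) =
      (λ le → outside∷-⊆ inside _ _ (proj₁ (ord x (swapAdj a y) (ascent⇒≤u x px ax) (descent⇒swap≤u y py dy))
          (proj₂ (lifting a le (DistinctEntries-≤B⁻ py dus) (range-≤us y py) ax dy)))) ,
      (λ h → proj₂ (ord x (swapAdj a y) (ascent⇒≤u x px ax) (descent⇒swap≤u y py dy)) (∷⁻-⊆ _ _ _ _ h) ◅◅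
          (descent⇒BStep a y (range-≤us y py) dy ◅ ε))
    tag-order x y px py (inj₂ dx) (inj₁ ay') =
      (λ le → ⊥-elim (<-asym dx (≤u⇒ascent x (le ◅◅ ascent⇒≤u y py ay')))) ,
      (λ h → ⊥-elim (inside∷⊈outside∷ _ _ h))

    tag-injective : ∀ x y (px : x ≤B us) (py : y ≤B us) sx sy → tag x px sx ≡ tag y py sy → x ≡ y
    tag-injective x y px py (inj₁ ax) (inj₁ ay') E = inj x y _ _ (Vec.∷-injectiveʳ E)
    tag-injective x y px py (inj₂ dx) (inj₂ dy) E =
        trans (sym (swapAdj-involutive a x (range-≤us x px)))
        (trans (cong (swapAdj a) (inj _ _ _ _ (Vec.∷-injectiveʳ E))) (swapAdj-involutive a y (range-≤us y py)))
    tag-injective x y px py (inj₁ ax) (inj₂ dy) ()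
    tag-injective x y px py (inj₂ dx) (inj₁ ay') ()

    tag-ascent : ∀ y (py : y ≤B u) (y≤us : y ≤B us) sy → tag y y≤us sy ≡ outside ∷ f y py
    tag-ascent y py y≤us (inj₁ ax) = cong (outside ∷_) (f-irrelevant y y _ py refl)
    tag-ascent y py y≤us (inj₂ dx) = ⊥-elim (<-asym dx (≤u⇒ascent y py))

    tag-descent : ∀ y (py : y ≤B u) (px : swapAdj a y ≤B us) sx → tag (swapAdj a y) px sx ≡ inside ∷ f y py
    tag-descent y py px (inj₂ dx) = cong (inside ∷_)
        (f-irrelevant (swapAdj a (swapAdj a y)) y _ py (swapAdj-involutive a y (range-≤u y py)))
    tag-descent y py px (inj₁ ax) = ⊥-elim (<-asym ax (ascent⇒descent-swapAdj a y (range-≤u y py) (≤u⇒ascent y py)))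

    g-surjective : ∀ (S : Subset (suc m)) → ∃[ x ] Σ (x ≤B us) λ p → g x p ≡ S
    g-surjective (outside ∷ T) with surj T
    ... | y , py , fy = y , y≤us , trans (tag-ascent y py y≤us (ascent⊎descent-≤us y y≤us)) (cong (outside ∷_) fy)
      where
      y≤us = py ◅◅ (ascent⇒BStep a u ru ay ◅ ε)
    g-surjective (inside ∷ T) with surj T
    ... | y , py , fy = swapAdj a y , px , trans (tag-descent y py px (ascent⊎descent-≤us (swapAdj a y) px))
          (cong (inside ∷_) fy)
      where
      px = lifting-ascents a py du ru (≤u⇒ascent y py) ay

    isBoolean : IsBoolean us
    isBoolean = suc m , g , (λ x y px py → tag-order x y px py (ascent⊎descent-≤us x px) (ascent⊎descent-≤us y py)) ,
        (λ x y px py → tag-injective x y px py (ascent⊎descent-≤us x px) (ascent⊎descent-≤us y py)) , g-surjective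

  repetitionless⇒boolean : ∀ σ → Reduced σ → Repetitionless σ → IsBoolean (perm σ)
  repetitionless⇒boolean [] _ _ = e-boolean
  repetitionless⇒boolean (a ∷ ω) (l , ay , red) (a∉ , dω) with repetitionless⇒boolean ω red dω
  ... | m , f , ord , inj , surj = BooleanExtension.isBoolean a ω l ay red a∉ m f ord inj surj

  -- Reduced words and decidability of the Bruhat order

  noDescent⇒≡e : ∀ v → v ↭ e → (∀ a → Gen a → ¬ Descent a v) → v ≡ e
  noDescent⇒≡e v p h = ≋⇒≡ (↗↭↗⇒≋ ≤-totalOrder sv se (↭⇒↭ₛ′ (TotalOrder.isEquivalence ≤-totalOrder) p))
    where
    lv : length v ≡ n
    lv = trans (↭-length p) length-e
    sv : Linked _≤_ v
    sv = Linked-at v (λ a a1 al → ≮⇒≥ (h a (a1 , subst (suc a ≤_) lv al)))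
    se : Linked _≤_ e
    se = Linked-at e (λ a a1 al → ≤-trans (≤-reflexive (at-e a a1 (≤-trans (n≤1+n a) (subst (suc a ≤_) length-e al))))
                      (≤-trans (n≤1+n a) (≤-reflexive (sym (at-e (suc a) (s≤s z≤n) (subst (suc a ≤_) length-e al))))))

  reducedWord-bounded : ∀ f v → inv v ≤ f → v ↭ e → Σ (List ℕ) λ ρ → Reduced ρ × perm ρ ≡ v
  reducedWord-bounded f v le p with boundedSearch (λ a → Gen a × Descent a v)
      (λ a → ((1 ≤? a) ×-dec (suc a ≤? n)) ×-dec (at v (suc a) <? at v a)) n
  ... | inj₂ h = [] , tt , sym (noDescent⇒≡e v p (λ a l d → h a (proj₂ l) (l , d)))
  ... | inj₁ (a , _ , (l , d)) = go f le
    where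
    lv : length v ≡ n
    lv = trans (↭-length p) length-e
    rv : AdjInRange a v
    rv = proj₁ l , subst (suc a ≤_) (sym lv) (proj₂ l)
    v' = swapAdj a v
    rv' : AdjInRange a v'
    rv' = AdjInRange-swapPos a a (suc a) v rv
    av' : Ascent a v'
    av' = descent⇒ascent-swapAdj a v rv d
    ieq : inv v ≡ suc (inv v')
    ieq = trans (cong inv (sym (swapAdj-involutive a v rv))) (inv-swapAdj-ascent a v' rv' av')
    go : ∀ f → inv v ≤ f → Σ (List ℕ) λ ρ → Reduced ρ × perm ρ ≡ v
    go zero le' = ⊥-elim (1+n≰n (≤-trans (≤-reflexive (sym ieq)) (≤-trans le' z≤n)))
    go (suc f') le' with reducedWord-bounded f' v' (≤-pred (≤-trans (≤-reflexive (sym ieq)) le'))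
        (↭-trans (swapAdj-↭ a v rv) p)
    ... | ρ , red , eq = (a ∷ ρ) , (l , subst (Ascent a) (sym eq) av' , red) ,
          trans (cong (swapAdj a) eq) (swapAdj-involutive a v rv)

  reducedWord : ∀ v → v ↭ e → Σ (List ℕ) λ ρ → Reduced ρ × perm ρ ≡ v
  reducedWord v p = reducedWord-bounded (inv v) v ≤-refl p

  ≤B-dec : ∀ v → v ↭ e → ∀ x → Dec (x ≤B v)
  ≤B-dec v p x with reducedWord v p
  ... | ρ , red , eq with subword-dec ρ (λ σ → perm σ ≡ x) (λ σ → ≡-dec _≟_ (perm σ) x)
  ...   | yes (σ , s , q) = yes (subst₂ _≤B_ q eq (subword⇒≤B σ ρ s red))
  ...   | no h = no λ x≤v → let (σ , s , _ , perm≡x) = ≤B⇒subword ρ x red (subst (x ≤B_) (sym eq) x≤v) in h (σ , s , perm≡x)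

  mkBraidIndex : ∀ k → 1 ≤ k → k ≤ n ∸ 2 → BraidIndex k
  mkBraidIndex k 1≤k k≤n∸2 = 1≤k , ≤∸2⇒2+≤ n k 1≤k k≤n∸2

  Letter⇒Gen : ∀ a → Letter n a → Gen a
  Letter⇒Gen a (1≤a , a≤n∸1) = 1≤a , ≤∸1⇒1+≤ n a 1≤a a≤n∸1

  Gen⇒Letter : ∀ a → Gen a → Letter n a
  Gen⇒Letter a (1≤a , a<n) = 1≤a , 1+≤⇒≤∸1 n a a<n

  ReducedWord⇒Reduced : ∀ v ω → ReducedWord n v ω → Reduced (reverse ω) × perm (reverse ω) ≡ v
  ReducedWord⇒Reduced v ω (letters , prod≡v , length≡inv) =
    inv≡length⇒Reduced (reverse ω) gens (trans (cong inv perm≡v) (trans (sym length≡inv) (sym (length-reverse ω)))) ,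
        perm≡v
    where
    gens : All Gen (reverse ω)
    gens = tabulate (λ m → Letter⇒Gen _ (All-lookup letters (AnyP.reverse⁻ m)))
    perm≡v : perm (reverse ω) ≡ v
    perm≡v = trans (sym (prod≡perm-reverse ω)) prod≡v

  Reduced⇒ReducedWord : ∀ v ρ → Reduced ρ → perm ρ ≡ v → ReducedWord n v (reverse ρ)
  Reduced⇒ReducedWord v ρ red perm≡v =
    tabulate (λ m → Gen⇒Letter _ (All-lookup (Reduced⇒AllGen ρ red) (AnyP.reverse⁻ m))) ,
    trans (prod≡perm-reverse (reverse ρ)) (trans (cong perm (reverse-involutive ρ)) perm≡v) ,
    trans (length-reverse ρ) (sym (trans (cong inv (sym perm≡v)) (inv-perm-Reduced ρ red)))

  BraidPattern⇒braidPerm-≤B : ∀ σ → Reduced σ → BraidPattern σ → ∃[ k ] (1 ≤ k × k ≤ n ∸ 2 × braidPerm k ≤B perm σ)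
  BraidPattern⇒braidPerm-≤B σ red (a , ga , inj₁ (ga' , sub)) = a , proj₁ ga , 2+≤⇒≤∸2 n a (proj₂ ga') ,
      subword⇒≤B _ σ sub red
  BraidPattern⇒braidPerm-≤B σ red (.(suc a) , ga' , inj₂ (a , refl , ga , sub)) =
    a , proj₁ ga , 2+≤⇒≤∸2 n a (proj₂ ga') ,
    subst (_≤B perm σ) (sym (Braid.braid-relation a (proj₁ ga , proj₂ ga'))) (subword⇒≤B _ σ sub red)

  BraidBelowBoth : List ℕ → List ℕ → Set
  BraidBelowBoth v w = ∃[ k ] (1 ≤ k × k ≤ n ∸ 2 × braidPerm k ≤B v × braidPerm k ≤B w)

  ¬boolean⇒BraidBelowBoth : ∀ v w → v ↭ e → w ↭ e → ¬ BooleanIntersection v w → BraidBelowBoth v w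
  ¬boolean⇒BraidBelowBoth v w v↭e w↭e ¬boolean with boundedSearch
      (λ k → 1 ≤ k × k ≤ n ∸ 2 × braidPerm k ≤B v × braidPerm k ≤B w)
    (λ k → (1 ≤? k) ×-dec ((k ≤? n ∸ 2) ×-dec (≤B-dec v v↭e (braidPerm k) ×-dec ≤B-dec w w↭e (braidPerm k))))
        (suc (n ∸ 2))
  ... | inj₁ (k , _ , below) = k , below
  ... | inj₂ none = ⊥-elim (¬boolean boolean)
    where
    boolean : BooleanIntersection v w
    boolean u u≤v u≤w with reducedWord v v↭e
    ... | ρ , red , perm≡v with ≤B⇒subword ρ u red (subst (u ≤B_) (sym perm≡v) u≤v)
    ...   | σ , _ , redσ , refl with repetitionless⊎braidPattern σ redσ
    ...     | inj₁ rep = repetitionless⇒boolean σ redσ rep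
    ...     | inj₂ pat with BraidPattern⇒braidPerm-≤B σ redσ pat
    ...       | k , 1≤k , k≤n∸2 , le = ⊥-elim (none k (s≤s k≤n∸2) (1≤k , k≤n∸2 , le ◅◅ u≤v , le ◅◅ u≤w))

  BraidBelowBoth⇒¬boolean : ∀ v w → BraidBelowBoth v w → ¬ BooleanIntersection v w
  BraidBelowBoth⇒¬boolean v w (k , 1≤k , k≤n∸2 , below-v , below-w) boolean =
    braidPerm-¬boolean k (mkBraidIndex k 1≤k k≤n∸2) (boolean (braidPerm k) below-v below-w)

  ¬boolean⇔BraidBelowBoth : ∀ v w → v ↭ e → w ↭ e → (¬ BooleanIntersection v w) ⇔ BraidBelowBoth v w
  ¬boolean⇔BraidBelowBoth v w v↭e w↭e = mk⇔ (¬boolean⇒BraidBelowBoth v w v↭e w↭e) (BraidBelowBoth⇒¬boolean v w)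

  Interlaced⇒braidPerm-≤B : ∀ k → BraidIndex k → ∀ v → Interlaced n k v → braidPerm k ≤B v
  Interlaced⇒braidPerm-≤B k kr v (_ , ω , rw , kk'k⊎k'kk') =
      subst (braidPerm k ≤B_) perm≡v ([ below , below' ]′ kk'k⊎k'kk')
    where
    red = proj₁ (ReducedWord⇒Reduced v ω rw)
    perm≡v = proj₂ (ReducedWord⇒Reduced v ω rw)
    below : (k ∷ suc k ∷ k ∷ []) ⊑ ω → braidPerm k ≤B perm (reverse ω)
    below s = subword⇒≤B _ _ (sub-reverse⁺ s) red
    below' : (suc k ∷ k ∷ suc k ∷ []) ⊑ ω → braidPerm k ≤B perm (reverse ω)
    below' s = subst (_≤B perm (reverse ω)) (sym (Braid.braid-relation k kr)) (subword⇒≤B _ _ (sub-reverse⁺ s) red)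

  braidPerm-≤B⇒Interlaced : ∀ k → BraidIndex k → ∀ v → v ↭ e → braidPerm k ≤B v → Interlaced n k v
  braidPerm-≤B⇒Interlaced k kr v v↭e le with reducedWord v v↭e
  ... | ρ , red , perm≡v with ≤B⇒subword ρ (braidPerm k) red (subst (braidPerm k ≤B_) (sym perm≡v) le)
  ...   | σ , s , redσ , eqσ with braidPerm-reducedWords k kr σ redσ eqσ
  ...     | inj₁ refl = (reverse ρ , rw , Any-resp-⊆ sω (here refl) , Any-resp-⊆ sω (there (here refl))) ,
        (reverse ρ , rw , inj₁ sω)
    where
    rw = Reduced⇒ReducedWord v ρ red perm≡v
    sω = sub-reverse⁺ s
  ...     | inj₂ refl = (reverse ρ , rw , Any-resp-⊆ sω (there (here refl)) , Any-resp-⊆ sω (here refl)) ,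
        (reverse ρ , rw , inj₂ sω)
    where
    rw = Reduced⇒ReducedWord v ρ red perm≡v
    sω = sub-reverse⁺ s

  BraidBelowBoth⇔Interlaced : ∀ v w → v ↭ e → w ↭ e →
    BraidBelowBoth v w ⇔ (∃[ k ] (1 ≤ k × k ≤ n ∸ 2 × Interlaced n k v × Interlaced n k w))
  BraidBelowBoth⇔Interlaced v w v↭e w↭e = mk⇔
    (λ (k , 1≤k , k≤n∸2 , below-v , below-w) → let kr = mkBraidIndex k 1≤k k≤n∸2 in
      k , 1≤k , k≤n∸2 , braidPerm-≤B⇒Interlaced k kr v v↭e below-v , braidPerm-≤B⇒Interlaced k kr w w↭e below-w)
    (λ (k , 1≤k , k≤n∸2 , il-v , il-w) → let kr = mkBraidIndex k 1≤k k≤n∸2 in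
      k , 1≤k , k≤n∸2 , Interlaced⇒braidPerm-≤B k kr v il-v , Interlaced⇒braidPerm-≤B k kr w il-w)

theorem2p2 : (n : ℕ) → 3 ≤ n → (v w : List ℕ) → IsPerm n v → IsPerm n w →
    ((¬ BooleanIntersection v w) ⇔
    (∃[ k ] (1 ≤ k × k ≤ n ∸ 2 ×
    prod n (k ∷ suc k ∷ k ∷ []) ≤B v × prod n (k ∷ suc k ∷ k ∷ []) ≤B w))) ×
    ((¬ BooleanIntersection v w) ⇔
    (∃[ k ] (1 ≤ k × k ≤ n ∸ 2 × Interlaced n k v × Interlaced n k w)))
theorem2p2 n _ v w v↭e w↭e =
  ¬boolean⇔BraidBelowBoth n v w v↭e w↭e ,
  ⇔-trans (¬boolean⇔BraidBelowBoth n v w v↭e w↭e) (BraidBelowBoth⇔Interlaced n v w v↭e w↭e)
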